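{- Let $n\ge1$, let $R_n$ be the $n\times n$ real matrix whose $(i,j)$ entry is $\binom{i-1}{n-j}$, and let $\lambda_1,\ldots,\lambda_n$ be its eigenvalues listed in decreasing order of absolute value (namely, with $\phi=\frac{1+\sqrt5}{2}$, $\bar\phi=\frac{1-\sqrt5}{2}$: for $n=2k$ the numbers $(-1)^{k+i}\phi^{2i-1},(-1)^{k+i}\bar\phi^{2i-1}$, $i=1,\dots,k$; for $n=2k+1$ the number $(-1)^k$ and $(-1)^{k+i}\phi^{2i},(-1)^{k+i}\bar\phi^{2i}$, $i=1,\dots,k$; these have distinct absolute values). Let $K_n$ be the $n\times n$ matrix with $(i,j)$ entry $\delta_{i,n-j+1}$, let $X_n$ be the $n\times n$ matrix with $(i,j)$ entry $\binom{n-i}{j-1}F_{i-2}^{\,j-1}F_{i-1}^{\,n-j}$, and let $V_n$ be the Vandermonde matrix with $(i,j)$ entry $\lambda_j^{\,i-1}$. Then $X_n$ is invertible and $W_n:=K_nX_n^{ -1}V_n$ is an eigenvector matrix of $R_n$ with eigenvectors listed in decreasing order of absolute value of the corresponding eigenvalues, i.e. $R_nW_n=W_n\,\mathrm{diag}(\lambda_1,\ldots,\lambda_n)$.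
   Context: $\delta$ is the Kronecker symbol, so $K_n$ is the permutation matrix with $1$'s on the secondary diagonal. $F_m$ is the Fibonacci sequence with $F_0=0$, $F_1=1$, $F_{m+1}=F_m+F_{m-1}$, extended by $F_{ -1}=1$; $0^0=1$. Binomial coefficients $\binom{a}{b}$ are $0$ when $b<0$ or $b>a$. -}

module Defs where

open import Data.Nat as ℕ using (ℕ; zero; suc; _∸_; _%_; _<ᵇ_; _≡ᵇ_; ⌊_/2⌋)
open import Data.Nat.Combinatorics using (_C_)
open import Data.Integer as ℤ using (ℤ; +_)
open import Data.Rational as ℚ using (ℚ; 0ℚ; 1ℚ)
open import Data.Fin using (Fin; zero; suc; toℕ)
open import Data.Bool using (if_then_else_)
open import Relation.Binary.PropositionalEquality using (_≡_)

-- The field ℚ(φ) ⊂ ℝ, φ = (1+√5)/2.  An element ⟨ a , b ⟩ denotes a + b·φ,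
-- with φ² = φ + 1.  Since ℚ is normalised, _≡_ is equality of numbers.

record Qφ : Set where
  constructor ⟨_,_⟩
  field
    re : ℚ
    im : ℚ

infixl 6 _+φ_
infixl 7 _*φ_

_+φ_ : Qφ → Qφ → Qφ
⟨ a , b ⟩ +φ ⟨ c , d ⟩ = ⟨ a ℚ.+ c , b ℚ.+ d ⟩

-- (a + bφ)(c + dφ) = (ac + bd) + (ad + bc + bd)φ
_*φ_ : Qφ → Qφ → Qφ
⟨ a , b ⟩ *φ ⟨ c , d ⟩ = ⟨ a ℚ.* c ℚ.+ b ℚ.* d , a ℚ.* d ℚ.+ b ℚ.* c ℚ.+ b ℚ.* d ⟩

-φ_ : Qφ → Qφ
-φ ⟨ a , b ⟩ = ⟨ ℚ.- a , ℚ.- b ⟩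

0φ 1φ φ φ̄ : Qφ
0φ = ⟨ 0ℚ , 0ℚ ⟩
1φ = ⟨ 1ℚ , 0ℚ ⟩
φ  = ⟨ 0ℚ , 1ℚ ⟩
-- φ̄ = (1 - √5)/2 = 1 - φ
φ̄  = ⟨ 1ℚ , ℚ.- 1ℚ ⟩

ι : ℕ → Qφ
ι m = ⟨ + m ℚ./ 1 , 0ℚ ⟩

_^φ_ : Qφ → ℕ → Qφ
x ^φ zero  = 1φ
x ^φ suc m = x *φ (x ^φ m)

sgn : ℕ → Qφ
sgn m = if m % 2 ≡ᵇ 0 then 1φ else -φ 1φ

Mat : ℕ → Set
Mat n = Fin n → Fin n → Qφ

Σφ : (n : ℕ) → (Fin n → Qφ) → Qφ
Σφ zero    f = 0φ
Σφ (suc n) f = f zero +φ Σφ n (λ i → f (suc i))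

infixl 7 _·_
_·_ : ∀ {n} → Mat n → Mat n → Mat n
_·_ {n} A B i j = Σφ n (λ l → A i l *φ B l j)

idM : ∀ {n} → Mat n
idM i j = if toℕ i ≡ᵇ toℕ j then 1φ else 0φ

diag : ∀ {n} → (Fin n → Qφ) → Mat n
diag d i j = if toℕ i ≡ᵇ toℕ j then d j else 0φ

infix 4 _≈M_
_≈M_ : ∀ {n} → Mat n → Mat n → Set
A ≈M B = ∀ i j → A i j ≡ B i j

-- Fibonacci numbers: fib m = F_m, and Fm1 m = F_{m-1} (with F_{-1} = 1).

fib : ℕ → ℕ
fib zero          = 0
fib (suc zero)    = 1
fib (suc (suc m)) = fib (suc m) ℕ.+ fib m

Fm1 : ℕ → ℕ
Fm1 zero    = 1
Fm1 (suc m) = fib m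

-- The matrices of the paper (1-based (i,j) in the paper correspond to
-- 0-based (toℕ i, toℕ j) = (i-1, j-1) here).

Rm : (n : ℕ) → Mat n
Rm n i j = ι (toℕ i C (n ∸ suc (toℕ j)))

Km : (n : ℕ) → Mat n
Km n i j = if suc (toℕ i) ≡ᵇ (n ∸ toℕ j) then 1φ else 0φ

Xm : (n : ℕ) → Mat n
Xm n i j = ι (((n ∸ 1) C toℕ j)
              ℕ.* (Fm1 (toℕ i) ℕ.^ toℕ j)
              ℕ.* (fib (toℕ i) ℕ.^ (n ∸ suc (toℕ j))))

-- The eigenvalues λ_1,…,λ_n of R_n in decreasing order of absolute value
-- (eig n j = λ_{j+1}), as listed in the paper:
--  n = 2k   : (-1)^{k+i} φ^{2i-1} for i = k,…,1, then (-1)^{k+i} φ̄^{2i-1} for i = 1,…,k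
--  n = 2k+1 : (-1)^{k+i} φ^{2i}   for i = k,…,1, then (-1)^k,
--             then (-1)^{k+i} φ̄^{2i} for i = 1,…,k
eig : (n : ℕ) → Fin n → Qφ
eig n j =
  if n % 2 ≡ᵇ 0
  then (if j0 <ᵇ k
        then sgn (k ℕ.+ (k ∸ j0)) *φ (φ ^φ (2 ℕ.* (k ∸ j0) ∸ 1))
        else sgn (k ℕ.+ (suc j0 ∸ k)) *φ (φ̄ ^φ (2 ℕ.* (suc j0 ∸ k) ∸ 1)))
  else (if j0 <ᵇ k
        then sgn (k ℕ.+ (k ∸ j0)) *φ (φ ^φ (2 ℕ.* (k ∸ j0)))
        else (if j0 ≡ᵇ k
              then sgn k
              else sgn (k ℕ.+ (j0 ∸ k)) *φ (φ̄ ^φ (2 ℕ.* (j0 ∸ k)))))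
  where
    k  = ⌊ n /2⌋
    j0 = toℕ j

Vm : (n : ℕ) → Mat n
Vm n i j = eig n j ^φ toℕ i

-- Write n = d + 1. Row i of X_n is the binomial form Σ_j C(d,j) F_{i-1}^j F_i^(d-j) v_j, i.e. the
-- polynomial Σ_j C(d,j) v_j x^j evaluated homogeneously at the point (F_{i-1} : F_i). By d'Ocagne's
-- identity these d + 1 points are distinct, so polynomial interpolation at x = F_k / F_{k+1} (plus the
-- leading coefficient, read off at (1 : 0)) makes X_n injective and gives it a right inverse, hence an
-- inverse. Since F_{i-1} + F_i γ = γ^i for γ ∈ {φ, φ̄}, the weighted coefficient vector of
-- (x + φ)^(d-j) (x + φ̄)^j is sent by row i to (φ^(d-j) φ̄^j)^i, so X_n E = V_n for the matrix E of
-- these vectors, and φ^(d-j) φ̄^j is the listed eigenvalue λ_{j+1}. Summing C(d,l) C(d-l,m) against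
-- the binomial theorem shows that X_n S is X_n with its rows shifted by one, where S = (C(d-l, m));
-- hence S E = E Λ. Finally R_n K_n = K_n S, so W_n = K_n X_n^{-1} V_n = K_n E satisfies R_n W_n = W_n Λ.

module Submission where

open import Defs
open import Level using (0ℓ)
open import Data.Bool using (Bool; true; false; if_then_else_)
open import Data.Empty using (⊥)
open import Data.Fin using (Fin; zero; suc; toℕ; fromℕ; fromℕ<; opposite)
import Data.Fin.Properties as Fin
import Data.Integer as ℤ
import Data.Integer.Properties as ℤ
open import Data.List using ([]; _∷_)
open import Data.Nat as ℕ
  using (ℕ; zero; suc; _+_; _*_; _^_; _∸_; _≤_; _<_; z≤n; s≤s; z<s; s<s; _!; _<ᵇ_; _≡ᵇ_; _%_; ⌊_/2⌋)
import Data.Nat.Properties as ℕ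
open import Data.Nat.Combinatorics using (_C_; nCn≡1; nCk≡n!/k![n-k]!; k>n⇒nCk≡0; k![n∸k]!∣n!)
open import Data.Nat.Coprimality using (1-coprimeTo)
import Data.Nat.Coprimality as Coprime
open import Data.Nat.DivMod using (m/n*n≡m)
open import Data.Nat.Tactic.RingSolver using (solve-∀)
open import Data.Product using (Σ; _×_; _,_; proj₁; proj₂)
open import Data.Rational as ℚ using (ℚ; 0ℚ; 1ℚ; mkℚ)
import Data.Rational.Properties as ℚ
open import Data.Sum using (_⊎_; inj₁; inj₂; [_,_]′)
open import Function using (_∘_)
open import Relation.Binary.Bundles using (Setoid)
open import Relation.Binary.Definitions using (DecidableEquality)
open import Relation.Binary.PropositionalEquality hiding ([_])
import Relation.Binary.Reasoning.Setoid as SetoidReasoning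
open import Relation.Binary.Structures using (IsEquivalence)
open import Relation.Nullary using (yes; no; proof; dec⇒maybe; map′; _×-dec_)
open import Relation.Nullary.Decidable using (dec-true; dec-false)
open import Relation.Nullary.Reflects using (ofʸ; ofⁿ)
open import Algebra.Bundles using (CommutativeRing)
open import Algebra.Structures {A = Qφ} _≡_ using (IsCommutativeRing)
open import Algebra.Definitions {A = Qφ} _≡_
open import Algebra.Consequences.Propositional {A = Qφ}
  using (comm∧idˡ⇒id; comm∧invˡ⇒inv; comm∧distrʳ⇒distrˡ)
import Algebra.Properties.AbelianGroup as AbelianGroupProperties
import Algebra.Properties.CommutativeSemigroup as CommutativeSemigroupProperties
import Algebra.Properties.Group as GroupProperties
import Algebra.Properties.CommutativeSemiring.Binomial ℕ.+-*-commutativeSemiring as Binomial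
import Algebra.Properties.Monoid.Mult ℕ.+-0-monoid as Mult
import Algebra.Properties.Monoid.Sum ℕ.+-0-monoid as Sum
import Algebra.Properties.Semiring.Exp ℕ.+-*-semiring as Exp
import Tactic.RingSolver.Core.AlmostCommutativeRing as ACR
open import Tactic.RingSolver using (solve)

-- The ring ℚ(φ)

ℚ-ring : ACR.AlmostCommutativeRing 0ℓ 0ℓ
ℚ-ring = ACR.fromCommutativeRing ℚ.+-*-commutativeRing (λ x → dec⇒maybe (0ℚ ℚ.≟ x))

+φ-assoc : Associative _+φ_
+φ-assoc ⟨ a , b ⟩ ⟨ c , d ⟩ ⟨ e , f ⟩ = cong₂ ⟨_,_⟩ (ℚ.+-assoc a c e) (ℚ.+-assoc b d f)

+φ-comm : Commutative _+φ_
+φ-comm ⟨ a , b ⟩ ⟨ c , d ⟩ = cong₂ ⟨_,_⟩ (ℚ.+-comm a c) (ℚ.+-comm b d)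

+φ-identityˡ : LeftIdentity 0φ _+φ_
+φ-identityˡ ⟨ a , b ⟩ = cong₂ ⟨_,_⟩ (ℚ.+-identityˡ a) (ℚ.+-identityˡ b)

-φ-inverseˡ : LeftInverse 0φ -φ_ _+φ_
-φ-inverseˡ ⟨ a , b ⟩ = cong₂ ⟨_,_⟩ (ℚ.+-inverseˡ a) (ℚ.+-inverseˡ b)

*φ-comm : Commutative _*φ_
*φ-comm ⟨ a , b ⟩ ⟨ c , d ⟩ = cong₂ ⟨_,_⟩ (cong₂ ℚ._+_ (ℚ.*-comm a c) (ℚ.*-comm b d)) im
  where
  im : a ℚ.* d ℚ.+ b ℚ.* c ℚ.+ b ℚ.* d ≡ c ℚ.* b ℚ.+ d ℚ.* a ℚ.+ d ℚ.* b
  im = solve (a ∷ b ∷ c ∷ d ∷ []) ℚ-ring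

*φ-identityˡ : LeftIdentity 1φ _*φ_
*φ-identityˡ ⟨ a , b ⟩ = cong₂ ⟨_,_⟩ re im
  where
  re : 1ℚ ℚ.* a ℚ.+ 0ℚ ℚ.* b ≡ a
  re = solve (a ∷ b ∷ []) ℚ-ring
  im : 1ℚ ℚ.* b ℚ.+ 0ℚ ℚ.* a ℚ.+ 0ℚ ℚ.* b ≡ b
  im = solve (a ∷ b ∷ []) ℚ-ring

*φ-assoc : Associative _*φ_
*φ-assoc ⟨ a , b ⟩ ⟨ c , d ⟩ ⟨ e , f ⟩ = cong₂ ⟨_,_⟩ re im
  where
  re : (a ℚ.* c ℚ.+ b ℚ.* d) ℚ.* e ℚ.+ (a ℚ.* d ℚ.+ b ℚ.* c ℚ.+ b ℚ.* d) ℚ.* f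
     ≡ a ℚ.* (c ℚ.* e ℚ.+ d ℚ.* f) ℚ.+ b ℚ.* (c ℚ.* f ℚ.+ d ℚ.* e ℚ.+ d ℚ.* f)
  re = solve (a ∷ b ∷ c ∷ d ∷ e ∷ f ∷ []) ℚ-ring
  im : (a ℚ.* c ℚ.+ b ℚ.* d) ℚ.* f ℚ.+ (a ℚ.* d ℚ.+ b ℚ.* c ℚ.+ b ℚ.* d) ℚ.* e
         ℚ.+ (a ℚ.* d ℚ.+ b ℚ.* c ℚ.+ b ℚ.* d) ℚ.* f
     ≡ a ℚ.* (c ℚ.* f ℚ.+ d ℚ.* e ℚ.+ d ℚ.* f) ℚ.+ b ℚ.* (c ℚ.* e ℚ.+ d ℚ.* f)
         ℚ.+ b ℚ.* (c ℚ.* f ℚ.+ d ℚ.* e ℚ.+ d ℚ.* f)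
  im = solve (a ∷ b ∷ c ∷ d ∷ e ∷ f ∷ []) ℚ-ring

*φ-distribʳ : _*φ_ DistributesOverʳ _+φ_
*φ-distribʳ ⟨ a , b ⟩ ⟨ c , d ⟩ ⟨ e , f ⟩ = cong₂ ⟨_,_⟩ re im
  where
  re : (c ℚ.+ e) ℚ.* a ℚ.+ (d ℚ.+ f) ℚ.* b ≡ (c ℚ.* a ℚ.+ d ℚ.* b) ℚ.+ (e ℚ.* a ℚ.+ f ℚ.* b)
  re = solve (a ∷ b ∷ c ∷ d ∷ e ∷ f ∷ []) ℚ-ring
  im : (c ℚ.+ e) ℚ.* b ℚ.+ (d ℚ.+ f) ℚ.* a ℚ.+ (d ℚ.+ f) ℚ.* b
     ≡ (c ℚ.* b ℚ.+ d ℚ.* a ℚ.+ d ℚ.* b) ℚ.+ (e ℚ.* b ℚ.+ f ℚ.* a ℚ.+ f ℚ.* b)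
  im = solve (a ∷ b ∷ c ∷ d ∷ e ∷ f ∷ []) ℚ-ring

_≟φ_ : DecidableEquality Qφ
⟨ a , b ⟩ ≟φ ⟨ c , d ⟩ =
  map′ (λ (p , q) → cong₂ ⟨_,_⟩ p q) (λ { refl → refl , refl }) ((a ℚ.≟ c) ×-dec (b ℚ.≟ d))

Qφ-isCommutativeRing : IsCommutativeRing _+φ_ _*φ_ -φ_ 0φ 1φ
Qφ-isCommutativeRing = record
  { isRing = record
    { +-isAbelianGroup = record
      { isGroup = record
        { isMonoid = record
          { isSemigroup = record
            { isMagma = record { isEquivalence = isEquivalence ; ∙-cong = cong₂ _+φ_ }
            ; assoc = +φ-assoc }
          ; identity = comm∧idˡ⇒id +φ-comm +φ-identityˡ }
        ; inverse = comm∧invˡ⇒inv +φ-comm -φ-inverseˡ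
        ; ⁻¹-cong = cong -φ_ }
      ; comm = +φ-comm }
    ; *-cong = cong₂ _*φ_
    ; *-assoc = *φ-assoc
    ; *-identity = comm∧idˡ⇒id *φ-comm *φ-identityˡ
    ; distrib = comm∧distrʳ⇒distrˡ *φ-comm *φ-distribʳ , *φ-distribʳ }
  ; *-comm = *φ-comm }

Qφ-commutativeRing : CommutativeRing 0ℓ 0ℓ
Qφ-commutativeRing = record { isCommutativeRing = Qφ-isCommutativeRing }

open CommutativeRing Qφ-commutativeRing
  using ()
  renaming ( +-identityʳ to +φ-identityʳ; -‿inverseʳ to -φ-inverseʳ; *-identityʳ to *φ-identityʳ
           ; distribˡ to *φ-distribˡ; zeroˡ to *φ-zeroˡ; zeroʳ to *φ-zeroʳ)

module *φ = CommutativeSemigroupProperties (CommutativeRing.*-commutativeSemigroup Qφ-commutativeRing)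
module +φ = CommutativeSemigroupProperties (CommutativeRing.+-commutativeSemigroup Qφ-commutativeRing)

Qφ-ring : ACR.AlmostCommutativeRing 0ℓ 0ℓ
Qφ-ring = ACR.fromCommutativeRing Qφ-commutativeRing (λ x → dec⇒maybe (0φ ≟φ x))

infixl 6 _−φ_
_−φ_ : Qφ → Qφ → Qφ
x −φ y = x +φ -φ y

x−y≡0⇒x≡y : ∀ x y → x −φ y ≡ 0φ → x ≡ y
x−y≡0⇒x≡y = GroupProperties.x∙y⁻¹≈ε⇒x≈y (CommutativeRing.+-group Qφ-commutativeRing)

ℚ-embed : ℚ → Qφ
ℚ-embed q = ⟨ q , 0ℚ ⟩

ℚ-embed-homo-* : ∀ p q → ℚ-embed p *φ ℚ-embed q ≡ ℚ-embed (p ℚ.* q)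
ℚ-embed-homo-* p q = cong₂ ⟨_,_⟩ re im
  where
  re : p ℚ.* q ℚ.+ 0ℚ ℚ.* 0ℚ ≡ p ℚ.* q
  re = solve (p ∷ q ∷ []) ℚ-ring
  im : p ℚ.* 0ℚ ℚ.+ 0ℚ ℚ.* q ℚ.+ 0ℚ ℚ.* 0ℚ ≡ 0ℚ
  im = solve (p ∷ q ∷ []) ℚ-ring

ℚ-embed-invertible : ∀ q → q ≢ 0ℚ → LeftInvertible 1φ _*φ_ (ℚ-embed q)
ℚ-embed-invertible q q≢0 =
  ℚ-embed q⁻¹ , trans (ℚ-embed-homo-* q⁻¹ q) (cong ℚ-embed (ℚ.*-inverseˡ q))
  where
  instance _ = ℚ.≢-nonZero q≢0
  q⁻¹ = ℚ.1/ q

-- ℚ._/_ normalises through gcd, so ι m is only propositionally the canonical fraction m/1.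
fromℕ-mkℚ : ∀ m → ℤ.+ m ℚ./ 1 ≡ mkℚ (ℤ.+ m) 0 (Coprime.sym (1-coprimeTo m))
fromℕ-mkℚ m = ℚ.normalize-coprime (Coprime.sym (1-coprimeTo m))

ι-suc : ∀ m → ι (suc m) ≡ 1φ +φ ι m
ι-suc m = cong ℚ-embed (trans (cong (ℚ._/ 1) (cong (ℤ._+_ (ℤ.+ 1)) (sym (ℤ.*-identityʳ (ℤ.+ m)))))
                              (cong (1ℚ ℚ.+_) (sym (fromℕ-mkℚ m))))

ι-injective : ∀ {m k} → ι m ≡ ι k → m ≡ k
ι-injective {m} {k} e =
  ℤ.+-injective (cong ℚ.numerator (trans (sym (fromℕ-mkℚ m)) (trans (cong Qφ.re e) (fromℕ-mkℚ k))))

ι-homo-+ : ∀ m k → ι (m ℕ.+ k) ≡ ι m +φ ι k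
ι-homo-+ zero    k = sym (+φ-identityˡ (ι k))
ι-homo-+ (suc m) k = begin
  ι (suc (m ℕ.+ k))     ≡⟨ ι-suc (m ℕ.+ k) ⟩
  1φ +φ ι (m ℕ.+ k)     ≡⟨ cong (1φ +φ_) (ι-homo-+ m k) ⟩
  1φ +φ (ι m +φ ι k)    ≡⟨ +φ-assoc 1φ (ι m) (ι k) ⟨
  (1φ +φ ι m) +φ ι k    ≡⟨ cong (_+φ ι k) (ι-suc m) ⟨
  ι (suc m) +φ ι k      ∎
  where open ≡-Reasoning

ι-homo-* : ∀ m k → ι (m ℕ.* k) ≡ ι m *φ ι k
ι-homo-* zero    k = sym (*φ-zeroˡ (ι k))
ι-homo-* (suc m) k = begin
  ι (k ℕ.+ m ℕ.* k)            ≡⟨ ι-homo-+ k (m ℕ.* k) ⟩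
  ι k +φ ι (m ℕ.* k)           ≡⟨ cong (ι k +φ_) (ι-homo-* m k) ⟩
  ι k +φ ι m *φ ι k            ≡⟨ cong (_+φ ι m *φ ι k) (*φ-identityˡ (ι k)) ⟨
  1φ *φ ι k +φ ι m *φ ι k      ≡⟨ *φ-distribʳ (ι k) 1φ (ι m) ⟨
  (1φ +φ ι m) *φ ι k           ≡⟨ cong (_*φ ι k) (ι-suc m) ⟨
  ι (suc m) *φ ι k             ∎
  where open ≡-Reasoning

ι-invertible : ∀ m → m ≢ 0 → LeftInvertible 1φ _*φ_ (ι m)
ι-invertible m m≢0 = ℚ-embed-invertible (ℤ.+ m ℚ./ 1) (λ e → m≢0 (ι-injective (cong ℚ-embed e)))

^φ-homo-* : ∀ x m k → x ^φ (m ℕ.+ k) ≡ x ^φ m *φ x ^φ k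
^φ-homo-* x zero    k = sym (*φ-identityˡ (x ^φ k))
^φ-homo-* x (suc m) k = trans (cong (x *φ_) (^φ-homo-* x m k)) (sym (*φ-assoc x (x ^φ m) (x ^φ k)))

^φ-distrib-* : ∀ x y m → (x *φ y) ^φ m ≡ x ^φ m *φ y ^φ m
^φ-distrib-* x y zero    = sym (*φ-identityˡ 1φ)
^φ-distrib-* x y (suc m) = trans (cong ((x *φ y) *φ_) (^φ-distrib-* x y m)) (*φ.interchange x y (x ^φ m) (y ^φ m))

^φ-assocʳ : ∀ x m k → (x ^φ m) ^φ k ≡ x ^φ (m ℕ.* k)
^φ-assocʳ x m zero    = cong (x ^φ_) (sym (ℕ.*-zeroʳ m))
^φ-assocʳ x m (suc k) = begin
  x ^φ m *φ (x ^φ m) ^φ k    ≡⟨ cong (x ^φ m *φ_) (^φ-assocʳ x m k) ⟩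
  x ^φ m *φ x ^φ (m ℕ.* k)   ≡⟨ ^φ-homo-* x m (m ℕ.* k) ⟨
  x ^φ (m ℕ.+ m ℕ.* k)       ≡⟨ cong (x ^φ_) (ℕ.*-suc m k) ⟨
  x ^φ (m ℕ.* suc k)         ∎
  where open ≡-Reasoning

ι-homo-^ : ∀ m k → ι (m ℕ.^ k) ≡ ι m ^φ k
ι-homo-^ m zero    = refl
ι-homo-^ m (suc k) = trans (ι-homo-* m (m ℕ.^ k)) (cong (ι m *φ_) (ι-homo-^ m k))

^φ-invertible : ∀ {x} → LeftInvertible 1φ _*φ_ x → ∀ m → LeftInvertible 1φ _*φ_ (x ^φ m)
^φ-invertible {x} (y , yx≡1) m = y ^φ m , (begin
  y ^φ m *φ x ^φ m    ≡⟨ ^φ-distrib-* y x m ⟨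
  (y *φ x) ^φ m       ≡⟨ cong (_^φ m) yx≡1 ⟩
  1φ ^φ m             ≡⟨ 1^φ m ⟩
  1φ                  ∎)
  where
  open ≡-Reasoning
  1^φ : ∀ m → 1φ ^φ m ≡ 1φ
  1^φ zero    = refl
  1^φ (suc m) = trans (*φ-identityˡ (1φ ^φ m)) (1^φ m)

invertible-cancelˡ : ∀ {r} → LeftInvertible 1φ _*φ_ r → ∀ x → r *φ x ≡ 0φ → x ≡ 0φ
invertible-cancelˡ {r} (s , sr≡1) x rx≡0 = begin
  x               ≡⟨ *φ-identityˡ x ⟨
  1φ *φ x         ≡⟨ cong (_*φ x) sr≡1 ⟨
  (s *φ r) *φ x   ≡⟨ *φ-assoc s r x ⟩
  s *φ (r *φ x)   ≡⟨ cong (s *φ_) rx≡0 ⟩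
  s *φ 0φ         ≡⟨ *φ-zeroʳ s ⟩
  0φ              ∎
  where open ≡-Reasoning

-- Finite sums and matrices

Σφ-cong : ∀ n {f g : Fin n → Qφ} → (∀ i → f i ≡ g i) → Σφ n f ≡ Σφ n g
Σφ-cong zero    f≗g = refl
Σφ-cong (suc n) f≗g = cong₂ _+φ_ (f≗g zero) (Σφ-cong n (f≗g ∘ suc))

Σφ-zero : ∀ n {f : Fin n → Qφ} → (∀ i → f i ≡ 0φ) → Σφ n f ≡ 0φ
Σφ-zero zero    f≗0 = refl
Σφ-zero (suc n) f≗0 = trans (cong₂ _+φ_ (f≗0 zero) (Σφ-zero n (f≗0 ∘ suc))) (+φ-identityˡ 0φ)

Σφ-distrib-+ : ∀ n (f g : Fin n → Qφ) → Σφ n (λ i → f i +φ g i) ≡ Σφ n f +φ Σφ n g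
Σφ-distrib-+ zero    f g = sym (+φ-identityˡ 0φ)
Σφ-distrib-+ (suc n) f g = trans (cong (f zero +φ g zero +φ_) (Σφ-distrib-+ n (f ∘ suc) (g ∘ suc)))
                                 (+φ.interchange (f zero) (g zero) (Σφ n (f ∘ suc)) (Σφ n (g ∘ suc)))

Σφ-neg : ∀ n (f : Fin n → Qφ) → -φ Σφ n f ≡ Σφ n (λ i → -φ f i)
Σφ-neg zero    f = refl
Σφ-neg (suc n) f = trans (sym (⁻¹-∙-comm (f zero) (Σφ n (f ∘ suc)))) (cong (-φ f zero +φ_) (Σφ-neg n (f ∘ suc)))
  where open AbelianGroupProperties (CommutativeRing.+-abelianGroup Qφ-commutativeRing)

*φ-distribˡ-Σφ : ∀ n x (f : Fin n → Qφ) → x *φ Σφ n f ≡ Σφ n (λ i → x *φ f i)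
*φ-distribˡ-Σφ zero    x f = *φ-zeroʳ x
*φ-distribˡ-Σφ (suc n) x f = trans (*φ-distribˡ x (f zero) _) (cong (x *φ f zero +φ_) (*φ-distribˡ-Σφ n x (f ∘ suc)))

*φ-distribʳ-Σφ : ∀ n x (f : Fin n → Qφ) → Σφ n f *φ x ≡ Σφ n (λ i → f i *φ x)
*φ-distribʳ-Σφ n x f = trans (*φ-comm _ x) (trans (*φ-distribˡ-Σφ n x f) (Σφ-cong n (λ i → *φ-comm x (f i))))

Σφ-comm : ∀ m n (f : Fin m → Fin n → Qφ) →
          Σφ m (λ i → Σφ n (f i)) ≡ Σφ n (λ j → Σφ m (λ i → f i j))
Σφ-comm zero    n f = sym (Σφ-zero n (λ _ → refl))
Σφ-comm (suc m) n f = trans (cong (Σφ n (f zero) +φ_) (Σφ-comm m n (f ∘ suc))) (sym (Σφ-distrib-+ n (f zero) _))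

Σφ-select : ∀ n (f : Fin n → Qφ) i → (∀ j → j ≢ i → f j ≡ 0φ) → Σφ n f ≡ f i
Σφ-select (suc n) f zero    f≗0 =
  trans (cong (f zero +φ_) (Σφ-zero n (λ j → f≗0 (suc j) (λ ())))) (+φ-identityʳ (f zero))
Σφ-select (suc n) f (suc i) f≗0 =
  trans (cong₂ _+φ_ (f≗0 zero (λ ())) (Σφ-select n (f ∘ suc) i (λ j j≢i → f≗0 (suc j) (j≢i ∘ Fin.suc-injective))))
        (+φ-identityˡ (f (suc i)))

Σφ-distrib-− : ∀ n (f g : Fin n → Qφ) → Σφ n (λ i → f i −φ g i) ≡ Σφ n f −φ Σφ n g
Σφ-distrib-− n f g = trans (Σφ-distrib-+ n f (λ i → -φ g i)) (cong (Σφ n f +φ_) (sym (Σφ-neg n g)))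

if-≡ᵇ-≡ : ∀ {A : Set} {m k} {x y : A} → m ≡ k → (if m ℕ.≡ᵇ k then x else y) ≡ x
if-≡ᵇ-≡ {m = m} {k} {x} {y} m≡k = cong (if_then x else y) (dec-true (m ℕ.≟ k) m≡k)

if-≡ᵇ-≢ : ∀ {A : Set} {m k} {x y : A} → m ≢ k → (if m ℕ.≡ᵇ k then x else y) ≡ y
if-≡ᵇ-≢ {m = m} {k} {x} {y} m≢k = cong (if_then x else y) (dec-false (m ℕ.≟ k) m≢k)

n∸toℕ≡suc-opposite : ∀ {n} (j : Fin n) → n ∸ toℕ j ≡ suc (toℕ (opposite j))
n∸toℕ≡suc-opposite {suc n} j = trans (ℕ.+-∸-assoc 1 (Fin.toℕ≤pred[n] j)) (cong suc (sym (Fin.opposite-prop j)))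

module _ {n : ℕ} where

  idM-diagonal : (i : Fin n) → idM i i ≡ 1φ
  idM-diagonal i = if-≡ᵇ-≡ {m = toℕ i} {y = 0φ} refl

  idM-off-diagonal : {i j : Fin n} → i ≢ j → idM i j ≡ 0φ
  idM-off-diagonal i≢j = if-≡ᵇ-≢ (i≢j ∘ Fin.toℕ-injective)

  diag-diagonal : (d : Fin n → Qφ) (i : Fin n) → diag d i i ≡ d i
  diag-diagonal d i = if-≡ᵇ-≡ {m = toℕ i} {y = 0φ} refl

  diag-off-diagonal : (d : Fin n → Qφ) {i j : Fin n} → i ≢ j → diag d i j ≡ 0φ
  diag-off-diagonal d i≢j = if-≡ᵇ-≢ (i≢j ∘ Fin.toℕ-injective)

  Km-antidiagonal : (i j : Fin n) → opposite i ≡ j → Km n i j ≡ 1φ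
  Km-antidiagonal i j refl = if-≡ᵇ-≡ (begin
    suc (toℕ i)                        ≡⟨ cong (suc ∘ toℕ) (Fin.opposite-involutive i) ⟨
    suc (toℕ (opposite (opposite i)))  ≡⟨ n∸toℕ≡suc-opposite (opposite i) ⟨
    n ∸ toℕ (opposite i)               ∎)
    where open ≡-Reasoning

  Km-off-antidiagonal : (i j : Fin n) → opposite i ≢ j → Km n i j ≡ 0φ
  Km-off-antidiagonal i j ī≢j = if-≡ᵇ-≢ λ e → ī≢j (begin
    opposite i             ≡⟨ cong opposite (Fin.toℕ-injective (ℕ.suc-injective (trans e (n∸toℕ≡suc-opposite j)))) ⟩
    opposite (opposite j)  ≡⟨ Fin.opposite-involutive j ⟩
    j                      ∎)
    where open ≡-Reasoning

  ≈M-isEquivalence : IsEquivalence (_≈M_ {n})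
  ≈M-isEquivalence = record
    { refl  = λ i j → refl
    ; sym   = λ A≈B i j → sym (A≈B i j)
    ; trans = λ A≈B B≈C i j → trans (A≈B i j) (B≈C i j) }

  Mat-setoid : Setoid 0ℓ 0ℓ
  Mat-setoid = record { isEquivalence = ≈M-isEquivalence }

  ·-assoc : (A B C : Mat n) → (A · B) · C ≈M A · (B · C)
  ·-assoc A B C i j = begin
    Σφ n (λ l → Σφ n (λ m → A i m *φ B m l) *φ C l j)    ≡⟨ Σφ-cong n (λ l → *φ-distribʳ-Σφ n (C l j) _) ⟩
    Σφ n (λ l → Σφ n (λ m → (A i m *φ B m l) *φ C l j))  ≡⟨ Σφ-comm n n _ ⟩
    Σφ n (λ m → Σφ n (λ l → (A i m *φ B m l) *φ C l j))  ≡⟨ Σφ-cong n (λ m → Σφ-cong n (λ l → *φ-assoc (A i m) _ _)) ⟩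
    Σφ n (λ m → Σφ n (λ l → A i m *φ (B m l *φ C l j)))  ≡⟨ Σφ-cong n (λ m → *φ-distribˡ-Σφ n (A i m) _) ⟨
    Σφ n (λ m → A i m *φ Σφ n (λ l → B m l *φ C l j))    ∎
    where open ≡-Reasoning

  ·-congˡ : {A A′ : Mat n} (B : Mat n) → A ≈M A′ → A · B ≈M A′ · B
  ·-congˡ B A≈A′ i j = Σφ-cong n (λ l → cong (_*φ B l j) (A≈A′ i l))

  ·-congʳ : (A : Mat n) {B B′ : Mat n} → B ≈M B′ → A · B ≈M A · B′
  ·-congʳ A B≈B′ i j = Σφ-cong n (λ l → cong (A i l *φ_) (B≈B′ l j))

  idM-· : (A : Mat n) → idM · A ≈M A
  idM-· A i j = begin
    (idM · A) i j     ≡⟨ Σφ-select n _ i (λ l l≢i → trans (cong (_*φ A l j) (idM-off-diagonal (l≢i ∘ sym)))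
                                                            (*φ-zeroˡ (A l j))) ⟩
    idM i i *φ A i j  ≡⟨ cong (_*φ A i j) (idM-diagonal i) ⟩
    1φ *φ A i j       ≡⟨ *φ-identityˡ (A i j) ⟩
    A i j             ∎
    where open ≡-Reasoning

  ·-diag : (A : Mat n) (d : Fin n → Qφ) → A · diag d ≈M (λ i j → A i j *φ d j)
  ·-diag A d i j = begin
    (A · diag d) i j       ≡⟨ Σφ-select n _ j (λ l l≢j → trans (cong (A i l *φ_) (diag-off-diagonal d l≢j))
                                                                 (*φ-zeroʳ (A i l))) ⟩
    A i j *φ diag d j j    ≡⟨ cong (A i j *φ_) (diag-diagonal d j) ⟩
    A i j *φ d j           ∎
    where open ≡-Reasoning

  ·-idM : (A : Mat n) → A · idM ≈M A
  ·-idM A i j = trans (·-diag A (λ _ → 1φ) i j) (*φ-identityʳ (A i j))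

  Km-· : (A : Mat n) → Km n · A ≈M (λ i j → A (opposite i) j)
  Km-· A i j = begin
    (Km n · A) i j                           ≡⟨ Σφ-select n _ (opposite i) (λ l l≢ī →
                                                  trans (cong (_*φ A l j) (Km-off-antidiagonal i l (l≢ī ∘ sym)))
                                                        (*φ-zeroˡ (A l j))) ⟩
    Km n i (opposite i) *φ A (opposite i) j  ≡⟨ cong (_*φ A (opposite i) j) (Km-antidiagonal i _ refl) ⟩
    1φ *φ A (opposite i) j                   ≡⟨ *φ-identityˡ _ ⟩
    A (opposite i) j                         ∎
    where open ≡-Reasoning

  ·-Km : (A : Mat n) → A · Km n ≈M (λ i j → A i (opposite j))
  ·-Km A i j = begin
    (A · Km n) i j                           ≡⟨ Σφ-select n _ (opposite j) (λ l l≢j̄ →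
                                                  trans (cong (A i l *φ_) (Km-off-antidiagonal l j (l≢j̄ ∘ opposite-swap)))
                                                        (*φ-zeroʳ (A i l))) ⟩
    A i (opposite j) *φ Km n (opposite j) j  ≡⟨ cong (A i (opposite j) *φ_) (Km-antidiagonal _ j (Fin.opposite-involutive j)) ⟩
    A i (opposite j) *φ 1φ                   ≡⟨ *φ-identityʳ _ ⟩
    A i (opposite j)                         ∎
    where
    open ≡-Reasoning
    opposite-swap : ∀ {l} → opposite l ≡ j → l ≡ opposite j
    opposite-swap {l} l̄≡j = trans (sym (Fin.opposite-involutive l)) (cong opposite l̄≡j)

-- Polynomials and interpolation

eval : ∀ {m} → (Fin m → Qφ) → Qφ → Qφ
eval {zero}  u y = 0φ
eval {suc m} u y = u zero +φ y *φ eval (u ∘ suc) y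

eval-cong : ∀ {m} {u v : Fin m → Qφ} y → (∀ j → u j ≡ v j) → eval u y ≡ eval v y
eval-cong {zero}  y u≗v = refl
eval-cong {suc m} y u≗v = cong₂ _+φ_ (u≗v zero) (cong (y *φ_) (eval-cong y (u≗v ∘ suc)))

eval-Σφ : ∀ {m} (u : Fin m → Qφ) y → eval u y ≡ Σφ m (λ j → u j *φ y ^φ toℕ j)
eval-Σφ {zero}  u y = refl
eval-Σφ {suc m} u y = begin
  u zero +φ y *φ eval (u ∘ suc) y
    ≡⟨ cong (λ t → u zero +φ y *φ t) (eval-Σφ (u ∘ suc) y) ⟩
  u zero +φ y *φ Σφ m (λ j → u (suc j) *φ y ^φ toℕ j)
    ≡⟨ cong₂ _+φ_ (sym (*φ-identityʳ (u zero))) (*φ-distribˡ-Σφ m y (λ j → u (suc j) *φ y ^φ toℕ j)) ⟩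
  u zero *φ 1φ +φ Σφ m (λ j → y *φ (u (suc j) *φ y ^φ toℕ j))
    ≡⟨ cong (u zero *φ 1φ +φ_) (Σφ-cong m (λ j → *φ.x∙yz≈y∙xz y (u (suc j)) (y ^φ toℕ j))) ⟩
  u zero *φ 1φ +φ Σφ m (λ j → u (suc j) *φ (y *φ y ^φ toℕ j))
    ∎
  where open ≡-Reasoning

quotient : ∀ {m} → (Fin (suc m) → Qφ) → Qφ → Fin m → Qφ
quotient {suc m} u r zero    = eval (u ∘ suc) r
quotient {suc m} u r (suc j) = quotient (u ∘ suc) r j

eval-quotient : ∀ {m} (u : Fin (suc m) → Qφ) r y → eval u y ≡ eval u r +φ (y −φ r) *φ eval (quotient u r) y
eval-quotient {zero}  u r y = regroup (u zero) y r
  where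
  regroup : ∀ u₀ y r → u₀ +φ y *φ 0φ ≡ (u₀ +φ r *φ 0φ) +φ (y −φ r) *φ 0φ
  regroup u₀ y r = solve (u₀ ∷ y ∷ r ∷ []) Qφ-ring
eval-quotient {suc m} u r y = trans (cong (λ t → u zero +φ y *φ t) (eval-quotient (u ∘ suc) r y))
                                    (regroup (u zero) y r (eval (u ∘ suc) r) (eval (quotient (u ∘ suc) r) y))
  where
  regroup : ∀ u₀ y r a b → u₀ +φ y *φ (a +φ (y −φ r) *φ b) ≡ (u₀ +φ r *φ a) +φ (y −φ r) *φ (a +φ y *φ b)
  regroup u₀ y r a b = solve (u₀ ∷ y ∷ r ∷ a ∷ b ∷ []) Qφ-ring

x+y*0≡x : ∀ x y → x +φ y *φ 0φ ≡ x
x+y*0≡x x y = trans (cong (x +φ_) (*φ-zeroʳ y)) (+φ-identityʳ x)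

quotient-last : ∀ m (u : Fin (suc (suc m)) → Qφ) r → quotient u r (fromℕ m) ≡ u (fromℕ (suc m))
quotient-last zero    u r = x+y*0≡x (u (suc zero)) r
quotient-last (suc m) u r = quotient-last m (u ∘ suc) r

quotient-zero : ∀ {m} (u : Fin (suc m) → Qφ) r → (∀ j → quotient u r j ≡ 0φ) → eval u r ≡ 0φ → ∀ j → u j ≡ 0φ
quotient-zero {zero}  u r q≗0 u[r]≡0 zero    = trans (sym (x+y*0≡x (u zero) r)) u[r]≡0
quotient-zero {suc m} u r q≗0 u[r]≡0 zero    =
  trans (sym (trans (cong (λ t → u zero +φ r *φ t) (q≗0 zero)) (x+y*0≡x (u zero) r))) u[r]≡0
quotient-zero {suc m} u r q≗0 u[r]≡0 (suc j) = quotient-zero (u ∘ suc) r (q≗0 ∘ suc) (q≗0 zero) j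

withQuotient : ∀ {m} → (Fin m → Qφ) → Qφ → Qφ → Fin (suc m) → Qφ
withQuotient {zero}  q c r _       = c
withQuotient {suc m} q c r zero    = c −φ r *φ q zero
withQuotient {suc m} q c r (suc j) = withQuotient (q ∘ suc) (q zero) r j

eval-withQuotient : ∀ {m} (q : Fin m → Qφ) c r y → eval (withQuotient q c r) y ≡ c +φ (y −φ r) *φ eval q y
eval-withQuotient {zero}  q c r y = regroup c y r
  where
  regroup : ∀ c y r → c +φ y *φ 0φ ≡ c +φ (y −φ r) *φ 0φ
  regroup c y r = solve (c ∷ y ∷ r ∷ []) Qφ-ring
eval-withQuotient {suc m} q c r y = trans (cong (λ t → (c −φ r *φ q zero) +φ y *φ t) (eval-withQuotient (q ∘ suc) (q zero) r y))
                                          (regroup c r (q zero) y (eval (q ∘ suc) y))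
  where
  regroup : ∀ c r q₀ y e → (c −φ r *φ q₀) +φ y *φ (q₀ +φ (y −φ r) *φ e) ≡ c +φ (y −φ r) *φ (q₀ +φ y *φ e)
  regroup c r q₀ y e = solve (c ∷ r ∷ q₀ ∷ y ∷ e ∷ []) Qφ-ring

withQuotient-last : ∀ m (q : Fin (suc m) → Qφ) c r → withQuotient q c r (fromℕ (suc m)) ≡ q (fromℕ m)
withQuotient-last zero    q c r = refl
withQuotient-last (suc m) q c r = withQuotient-last m (q ∘ suc) (q zero) r

Distinct : (ℕ → Qφ) → Set
Distinct x = ∀ {i k} → i < k → LeftInvertible 1φ _*φ_ (x k −φ x i)

Distinct-suc : ∀ x → Distinct x → Distinct (x ∘ suc)
Distinct-suc x x-distinct i<k = x-distinct (s<s i<k)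

lowDegree-roots⇒zero : ∀ m x → Distinct x → (u : Fin (suc m) → Qφ) → u (fromℕ m) ≡ 0φ →
                       (∀ i → i < m → eval u (x i) ≡ 0φ) → ∀ j → u j ≡ 0φ
lowDegree-roots⇒zero zero    x x-distinct u u₀≡0 roots zero = u₀≡0
lowDegree-roots⇒zero (suc m) x x-distinct u uₘ≡0 roots =
  quotient-zero u (x 0) q≗0 (roots 0 z<s)
  where
  q = quotient u (x 0)
  q-roots : ∀ i → i < m → eval q (x (suc i)) ≡ 0φ
  q-roots i i<m = invertible-cancelˡ (x-distinct z<s) (eval q (x (suc i))) (begin
    (x (suc i) −φ x 0) *φ eval q (x (suc i))                 ≡⟨ +φ-identityˡ _ ⟨
    0φ +φ (x (suc i) −φ x 0) *φ eval q (x (suc i))           ≡⟨ cong (_+φ (x (suc i) −φ x 0) *φ eval q (x (suc i))) (roots 0 z<s) ⟨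
    eval u (x 0) +φ (x (suc i) −φ x 0) *φ eval q (x (suc i)) ≡⟨ eval-quotient u (x 0) (x (suc i)) ⟨
    eval u (x (suc i))                                       ≡⟨ roots (suc i) (s<s i<m) ⟩
    0φ                                                       ∎)
    where open ≡-Reasoning
  q≗0 : ∀ j → q j ≡ 0φ
  q≗0 = lowDegree-roots⇒zero m (x ∘ suc) (Distinct-suc x x-distinct) q (trans (quotient-last m u (x 0)) uₘ≡0) q-roots

-- Newton's step: u = z 0 + (x − x 0) q, where q interpolates the divided differences at x 1, x 2, ….
interpolant : ∀ m x → Distinct x → (c : Qφ) (z : ℕ → Qφ) →
              Σ (Fin (suc m) → Qφ) λ u → u (fromℕ m) ≡ c × (∀ i → i < m → eval u (x i) ≡ z i)
interpolant zero    x x-distinct c z = (λ _ → c) , refl , λ i ()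
interpolant (suc m) x x-distinct c z = u , trans (withQuotient-last m q (z 0) (x 0)) qₘ≡c , u-values
  where
  slope : ℕ → Qφ
  slope i = proj₁ (x-distinct (z<s {n = i})) *φ (z (suc i) −φ z 0)
  q-spec = interpolant m (x ∘ suc) (Distinct-suc x x-distinct) c slope
  q = proj₁ q-spec
  qₘ≡c = proj₁ (proj₂ q-spec)
  u = withQuotient q (z 0) (x 0)
  u-values : ∀ i → i < suc m → eval u (x i) ≡ z i
  u-values zero    _ = trans (eval-withQuotient q (z 0) (x 0) (x 0)) (cancel (z 0) (x 0) (eval q (x 0)))
    where
    cancel : ∀ c r e → c +φ (r −φ r) *φ e ≡ c
    cancel c r e = solve (c ∷ r ∷ e ∷ []) Qφ-ring
  u-values (suc i) (s<s i<m) = begin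
    eval u (x (suc i))
      ≡⟨ eval-withQuotient q (z 0) (x 0) (x (suc i)) ⟩
    z 0 +φ Δx *φ eval q (x (suc i))
      ≡⟨ cong (λ t → z 0 +φ Δx *φ t) (proj₂ (proj₂ q-spec) i i<m) ⟩
    z 0 +φ Δx *φ (s *φ Δz)
      ≡⟨ cong (z 0 +φ_) (*φ.x∙yz≈y∙xz Δx s Δz) ⟩
    z 0 +φ s *φ (Δx *φ Δz)
      ≡⟨ cong (z 0 +φ_) (*φ-assoc s Δx Δz) ⟨
    z 0 +φ (s *φ Δx) *φ Δz
      ≡⟨ cong (λ t → z 0 +φ t *φ Δz) (proj₂ (x-distinct z<s)) ⟩
    z 0 +φ 1φ *φ (z (suc i) −φ z 0)
      ≡⟨ cancel (z 0) (z (suc i)) ⟩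
    z (suc i)
      ∎
    where
    open ≡-Reasoning
    Δx Δz s : Qφ
    Δx = x (suc i) −φ x 0
    Δz = z (suc i) −φ z 0
    s = proj₁ (x-distinct (z<s {n = i}))
    cancel : ∀ a b → a +φ 1φ *φ (b −φ a) ≡ b
    cancel a b = solve (a ∷ b ∷ []) Qφ-ring

-- Binomial coefficients and Fibonacci numbers

ΣN : ℕ → (ℕ → ℕ) → ℕ
ΣN zero    g = 0
ΣN (suc n) g = g 0 + ΣN n (g ∘ suc)

ΣN-cong : ∀ n {f g : ℕ → ℕ} → (∀ l → l < n → f l ≡ g l) → ΣN n f ≡ ΣN n g
ΣN-cong zero    f≗g = refl
ΣN-cong (suc n) f≗g = cong₂ _+_ (f≗g 0 z<s) (ΣN-cong n (λ l l<n → f≗g (suc l) (s<s l<n)))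

ΣN-zero : ∀ n {f : ℕ → ℕ} → (∀ l → f l ≡ 0) → ΣN n f ≡ 0
ΣN-zero zero    f≗0 = refl
ΣN-zero (suc n) f≗0 = cong₂ _+_ (f≗0 0) (ΣN-zero n (f≗0 ∘ suc))

ΣN-+ : ∀ m n (f : ℕ → ℕ) → ΣN (m + n) f ≡ ΣN m f + ΣN n (λ l → f (m + l))
ΣN-+ zero    n f = refl
ΣN-+ (suc m) n f = trans (cong (f 0 +_) (ΣN-+ m n (f ∘ suc))) (sym (ℕ.+-assoc (f 0) _ _))

*-distribˡ-ΣN : ∀ n c (f : ℕ → ℕ) → ΣN n (λ l → c * f l) ≡ c * ΣN n f
*-distribˡ-ΣN zero    c f = sym (ℕ.*-zeroʳ c)
*-distribˡ-ΣN (suc n) c f = trans (cong (c * f 0 +_) (*-distribˡ-ΣN n c (f ∘ suc))) (sym (ℕ.*-distribˡ-+ c (f 0) _))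

nCk*k!*[n∸k]!≡n! : ∀ n k → k ≤ n → (n C k) * (k ! * (n ∸ k) !) ≡ n !
nCk*k!*[n∸k]!≡n! n k k≤n = trans (cong (_* (k ! * (n ∸ k) !)) (nCk≡n!/k![n-k]! k≤n))
                                  (m/n*n≡m {{k ℕ.!* (n ∸ k) !≢0}} (k![n∸k]!∣n! k≤n))

k≤n⇒nCk≢0 : ∀ n k → k ≤ n → n C k ≢ 0
k≤n⇒nCk≢0 n k k≤n nCk≡0 = ℕ.≢-nonZero⁻¹ (n !) {{n ℕ.!≢0}}
  (trans (sym (nCk*k!*[n∸k]!≡n! n k k≤n)) (cong (_* (k ! * (n ∸ k) !)) nCk≡0))

-- Multiplied by l! m! (n − l − m)! both sides give n!; if l + m > n both vanish.
nCl*[n∸l]Cm≡nCm*[n∸m]Cl : ∀ n l m → l ≤ n → m ≤ n → (n C l) * ((n ∸ l) C m) ≡ (n C m) * ((n ∸ m) C l)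
nCl*[n∸l]Cm≡nCm*[n∸m]Cl n l m l≤n m≤n with l + m ℕ.≤? n
... | no l+m≰n = trans (cong ((n C l) *_) (k>n⇒nCk≡0 (too-big l≤n (ℕ.≰⇒> l+m≰n))))
                       (trans (ℕ.*-zeroʳ (n C l))
                       (sym (trans (cong ((n C m) *_) (k>n⇒nCk≡0 (too-big m≤n (subst (n <_) (ℕ.+-comm l m) (ℕ.≰⇒> l+m≰n)))))
                                   (ℕ.*-zeroʳ (n C m)))))
  where
  too-big : ∀ {n l m} → l ≤ n → n < l + m → n ∸ l < m
  too-big z≤n       n<l+m       = n<l+m
  too-big (s≤s l≤n) (s<s n<l+m) = too-big l≤n n<l+m
... | yes l+m≤n = ℕ.*-cancelʳ-≡ _ _ (l ! * (m ! * r !)) {{nonZero}} (trans (lhs≡n!) (sym rhs≡n!))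
  where
  r = n ∸ l ∸ m
  nonZero = ℕ.m*n≢0 (l !) (m ! * r !) {{l ℕ.!≢0}} {{ℕ.m*n≢0 (m !) (r !) {{m ℕ.!≢0}} {{r ℕ.!≢0}}}}
  shuffleˡ : ∀ a b x y z → (a * b) * (x * (y * z)) ≡ (a * x) * (b * (y * z))
  shuffleˡ = solve-∀
  shuffleʳ : ∀ a b x y z → (a * b) * (x * (y * z)) ≡ (a * y) * (b * (x * z))
  shuffleʳ = solve-∀
  r≡n∸m∸l : r ≡ n ∸ m ∸ l
  r≡n∸m∸l = trans (ℕ.∸-+-assoc n l m) (trans (cong (n ∸_) (ℕ.+-comm l m)) (sym (ℕ.∸-+-assoc n m l)))
  lhs≡n! : (n C l) * ((n ∸ l) C m) * (l ! * (m ! * r !)) ≡ n !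
  lhs≡n! = trans (shuffleˡ (n C l) ((n ∸ l) C m) (l !) (m !) (r !))
           (trans (cong ((n C l) * l ! *_) (nCk*k!*[n∸k]!≡n! (n ∸ l) m (ℕ.m+n≤o⇒m≤o∸n m (subst (_≤ n) (ℕ.+-comm l m) l+m≤n))))
           (trans (ℕ.*-assoc (n C l) (l !) _) (nCk*k!*[n∸k]!≡n! n l l≤n)))
  rhs≡n! : (n C m) * ((n ∸ m) C l) * (l ! * (m ! * r !)) ≡ n !
  rhs≡n! = trans (shuffleʳ (n C m) ((n ∸ m) C l) (l !) (m !) (r !))
           (trans (cong (λ t → (n C m) * m ! * (((n ∸ m) C l) * (l ! * t !))) r≡n∸m∸l)
           (trans (cong ((n C m) * m ! *_) (nCk*k!*[n∸k]!≡n! (n ∸ m) l (ℕ.m+n≤o⇒m≤o∸n l l+m≤n)))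
           (trans (ℕ.*-assoc (n C m) (m !) _) (nCk*k!*[n∸k]!≡n! n m m≤n))))

binomial-theorem : ∀ n a b → ΣN (suc n) (λ l → (n C l) * a ^ l * b ^ (n ∸ l)) ≡ (a + b) ^ n
binomial-theorem n a b = sym (begin
  (a + b) ^ n                                                            ≡⟨ ^≗^ (a + b) n ⟨
  (a + b) Exp.^ n                                                        ≡⟨ Binomial.theorem n a b ⟩
  Binomial.binomialExpansion a b n                                       ≡⟨ sum≗ΣN (suc n) _ (λ l → (n C l) * a ^ l * b ^ (n ∸ l)) term ⟩
  ΣN (suc n) (λ l → (n C l) * a ^ l * b ^ (n ∸ l))                     ∎)
  where
  open ≡-Reasoning
  ^≗^ : ∀ x n → x Exp.^ n ≡ x ^ n
  ^≗^ x zero    = refl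
  ^≗^ x (suc n) = cong (x *_) (^≗^ x n)
  ×≗* : ∀ c y → c Mult.× y ≡ c * y
  ×≗* zero    y = refl
  ×≗* (suc c) y = cong (y +_) (×≗* c y)
  sum≗ΣN : ∀ n (f : Fin n → ℕ) (g : ℕ → ℕ) → (∀ k → f k ≡ g (toℕ k)) → Sum.sum f ≡ ΣN n g
  sum≗ΣN zero    f g f≗g = refl
  sum≗ΣN (suc n) f g f≗g = cong₂ _+_ (f≗g zero) (sum≗ΣN n (f ∘ suc) (g ∘ suc) (f≗g ∘ suc))
  term : ∀ (k : Fin (suc n)) → Binomial.binomialTerm a b n k ≡ (n C toℕ k) * a ^ toℕ k * b ^ (n ∸ toℕ k)
  term k = trans (×≗* (n C toℕ k) _)
           (trans (cong ((n C toℕ k) *_) (cong₂ _*_ (^≗^ a (toℕ k)) (^≗^ b (n ∸ toℕ k))))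
                  (sym (ℕ.*-assoc (n C toℕ k) (a ^ toℕ k) (b ^ (n ∸ toℕ k)))))

trinomial-sum : ∀ n m a b → m ≤ n →
  ΣN (suc n) (λ l → (n C l) * a ^ l * b ^ (n ∸ l) * ((n ∸ l) C m)) ≡ (n C m) * b ^ m * (a + b) ^ (n ∸ m)
trinomial-sum n m a b m≤n = begin
  ΣN (suc n) T                                            ≡⟨ ΣN-cong (suc n) (λ l l<1+n → term l (ℕ.s≤s⁻¹ l<1+n)) ⟩
  ΣN (suc n) (λ l → c * G l)                              ≡⟨ *-distribˡ-ΣN (suc n) c G ⟩
  c * ΣN (suc n) G                                        ≡⟨ cong (λ t → c * ΣN (suc t) G) (ℕ.m∸n+n≡m m≤n) ⟨
  c * ΣN (suc e + m) G                                    ≡⟨ cong (c *_) (ΣN-+ (suc e) m G) ⟩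
  c * (ΣN (suc e) G + ΣN m (λ l → G (suc e + l)))         ≡⟨ cong (λ t → c * (ΣN (suc e) G + t)) (ΣN-zero m G-vanishes) ⟩
  c * (ΣN (suc e) G + 0)                                  ≡⟨ cong (c *_) (trans (ℕ.+-identityʳ _) (binomial-theorem e a b)) ⟩
  c * (a + b) ^ e                                         ∎
  where
  open ≡-Reasoning
  e = n ∸ m
  c = (n C m) * b ^ m
  T G : ℕ → ℕ
  T l = (n C l) * a ^ l * b ^ (n ∸ l) * ((n ∸ l) C m)
  G l = (e C l) * a ^ l * b ^ (e ∸ l)
  G-vanishes : ∀ l → G (suc e + l) ≡ 0
  G-vanishes l = cong (λ t → t * a ^ (suc e + l) * b ^ (e ∸ (suc e + l))) (k>n⇒nCk≡0 (ℕ.m≤m+n (suc e) l))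
  regroupˡ : ∀ x y z w → x * y * z * w ≡ (x * w) * (y * z)
  regroupˡ = solve-∀
  regroupʳ : ∀ x y z w v → x * y * (z * (w * v)) ≡ x * v * (y * z * w)
  regroupʳ = solve-∀
  T≡CeCl : ∀ l → l ≤ n → T l ≡ (n C m) * (e C l) * (a ^ l * b ^ (n ∸ l))
  T≡CeCl l l≤n = trans (regroupˡ (n C l) (a ^ l) (b ^ (n ∸ l)) ((n ∸ l) C m))
                       (cong (_* (a ^ l * b ^ (n ∸ l))) (nCl*[n∸l]Cm≡nCm*[n∸m]Cl n l m l≤n m≤n))
  term : ∀ l → l ≤ n → T l ≡ c * G l
  term l l≤n with l ℕ.≤? e
  ... | yes l≤e = begin
    T l                                                ≡⟨ T≡CeCl l l≤n ⟩
    (n C m) * (e C l) * (a ^ l * b ^ (n ∸ l))          ≡⟨ cong (λ t → (n C m) * (e C l) * (a ^ l * b ^ t)) n∸l≡e∸l+m ⟩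
    (n C m) * (e C l) * (a ^ l * b ^ (e ∸ l + m))      ≡⟨ cong (λ t → (n C m) * (e C l) * (a ^ l * t)) (ℕ.^-distribˡ-+-* b (e ∸ l) m) ⟩
    (n C m) * (e C l) * (a ^ l * (b ^ (e ∸ l) * b ^ m)) ≡⟨ regroupʳ (n C m) (e C l) (a ^ l) (b ^ (e ∸ l)) (b ^ m) ⟩
    c * G l                                            ∎
    where
    n∸l≡e∸l+m : n ∸ l ≡ e ∸ l + m
    n∸l≡e∸l+m = trans (cong (_∸ l) (sym (ℕ.m∸n+n≡m m≤n))) (ℕ.+-∸-comm m l≤e)
  ... | no l≰e = trans (T≡CeCl l l≤n)
                 (trans (cong (λ t → (n C m) * t * (a ^ l * b ^ (n ∸ l))) eCl≡0)
                 (trans (cong (_* (a ^ l * b ^ (n ∸ l))) (ℕ.*-zeroʳ (n C m)))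
                 (sym (trans (cong (λ t → c * (t * a ^ l * b ^ (e ∸ l))) eCl≡0) (ℕ.*-zeroʳ c)))))
    where
    eCl≡0 : e C l ≡ 0
    eCl≡0 = k>n⇒nCk≡0 (ℕ.≰⇒> l≰e)

fib-suc≢0 : ∀ i → fib (suc i) ≢ 0
fib-suc≢0 zero    ()
fib-suc≢0 (suc i) e = fib-suc≢0 i (ℕ.m+n≡0⇒m≡0 (fib (suc i)) e)

fib-suc≡Fm1+fib : ∀ i → fib (suc i) ≡ Fm1 i + fib i
fib-suc≡Fm1+fib zero    = refl
fib-suc≡Fm1+fib (suc i) = ℕ.+-comm (fib (suc i)) (fib i)

-- d'Ocagne's identity F(i+m) F(i+1) − F(i) F(i+m+1) = (−1)^i F(m), with the sign split into two cases.
fib-dOcagne : ∀ i m → fib (i + m) * fib (suc i) ≡ fib i * fib (suc (i + m)) + fib m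
                    ⊎ fib i * fib (suc (i + m)) ≡ fib (i + m) * fib (suc i) + fib m
fib-dOcagne zero    m = inj₁ (ℕ.*-identityʳ (fib m))
fib-dOcagne (suc i) m =
  [ inj₂ ∘ step (fib (suc i)) (fib i) (fib (i + m)) (fib (suc (i + m))) (fib m)
  , inj₁ ∘ step (fib (suc (i + m))) (fib (i + m)) (fib i) (fib (suc i)) (fib m)
  ]′ (fib-dOcagne i m)
  where
  expand : ∀ x₁ x₀ y₀ y₁ f → x₁ * (y₁ + y₀) ≡ x₁ * y₁ + y₀ * x₁
  expand = solve-∀
  collect : ∀ x₁ x₀ y₁ f → x₁ * y₁ + (x₀ * y₁ + f) ≡ y₁ * (x₁ + x₀) + f
  collect = solve-∀
  step : ∀ x₁ x₀ y₀ y₁ f → y₀ * x₁ ≡ x₀ * y₁ + f → x₁ * (y₁ + y₀) ≡ y₁ * (x₁ + x₀) + f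
  step x₁ x₀ y₀ y₁ f e = trans (expand x₁ x₀ y₀ y₁ f) (trans (cong (x₁ * y₁ +_) e) (collect x₁ x₀ y₁ f))

fib-cross≢ : ∀ {i k} → i < k → fib k * fib (suc i) ≢ fib i * fib (suc k)
fib-cross≢ {i} {k} i<k cross with ℕ.m≤n⇒∃[o]m+o≡n i<k
... | o , 1+i+o≡k rewrite sym (trans (ℕ.+-suc i o) 1+i+o≡k) =
  [ (λ e → absurd (trans (sym e) cross)) , (λ e → absurd (trans (sym e) (sym cross))) ]′ (fib-dOcagne i (suc o))
  where
  absurd : ∀ {x} → x + fib (suc o) ≡ x → ⊥
  absurd {x} e = fib-suc≢0 o (ℕ.+-cancelˡ-≡ x (fib (suc o)) 0 (trans e (sym (ℕ.+-identityʳ x))))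

-- The eigenvalues

φ²≡φ+1 : φ *φ φ ≡ φ +φ 1φ
φ²≡φ+1 = refl

φ̄²≡φ̄+1 : φ̄ *φ φ̄ ≡ φ̄ +φ 1φ
φ̄²≡φ̄+1 = refl

φ*φ̄≡-1 : φ *φ φ̄ ≡ -φ 1φ
φ*φ̄≡-1 = refl

Fm1+fib*γ≡γ^ : ∀ γ → γ *φ γ ≡ γ +φ 1φ → ∀ i → ι (Fm1 i) +φ ι (fib i) *φ γ ≡ γ ^φ i
Fm1+fib*γ≡γ^ γ γ²≡γ+1 zero    = trans (cong (1φ +φ_) (*φ-zeroˡ γ)) (+φ-identityʳ 1φ)
Fm1+fib*γ≡γ^ γ γ²≡γ+1 (suc i) = begin
  ι (fib i) +φ ι (fib (suc i)) *φ γ               ≡⟨ cong (λ t → ι (fib i) +φ t *φ γ) (trans (cong ι (fib-suc≡Fm1+fib i)) (ι-homo-+ (Fm1 i) (fib i))) ⟩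
  ι (fib i) +φ (ι (Fm1 i) +φ ι (fib i)) *φ γ      ≡⟨ regroup (ι (Fm1 i)) (ι (fib i)) γ ⟩
  ι (Fm1 i) *φ γ +φ ι (fib i) *φ (γ +φ 1φ)        ≡⟨ cong (λ t → ι (Fm1 i) *φ γ +φ ι (fib i) *φ t) γ²≡γ+1 ⟨
  ι (Fm1 i) *φ γ +φ ι (fib i) *φ (γ *φ γ)         ≡⟨ factor (ι (Fm1 i)) (ι (fib i)) γ ⟩
  γ *φ (ι (Fm1 i) +φ ι (fib i) *φ γ)              ≡⟨ cong (γ *φ_) (Fm1+fib*γ≡γ^ γ γ²≡γ+1 i) ⟩
  γ ^φ suc i                                      ∎
  where
  open ≡-Reasoning
  regroup : ∀ a b g → b +φ (a +φ b) *φ g ≡ a *φ g +φ b *φ (g +φ 1φ)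
  regroup a b g = solve (a ∷ b ∷ g ∷ []) Qφ-ring
  factor : ∀ a b g → a *φ g +φ b *φ (g *φ g) ≡ g *φ (a +φ b *φ g)
  factor a b g = solve (a ∷ b ∷ g ∷ []) Qφ-ring

sgn-suc : ∀ m → sgn (suc m) ≡ -φ sgn m
sgn-suc zero          = refl
sgn-suc (suc zero)    = refl
sgn-suc (suc (suc m)) = sgn-suc m

sgn-+-double : ∀ m t → sgn (m + (t + t)) ≡ sgn m
sgn-+-double m zero    = cong sgn (ℕ.+-identityʳ m)
sgn-+-double m (suc t) = trans (cong sgn (+2 m t)) (sgn-+-double m t)
  where
  +2 : ∀ m t → m + (suc t + suc t) ≡ suc (suc (m + (t + t)))
  +2 = solve-∀

φ^m*φ̄^m≡sgn : ∀ m → φ ^φ m *φ φ̄ ^φ m ≡ sgn m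
φ^m*φ̄^m≡sgn zero    = refl
φ^m*φ̄^m≡sgn (suc m) = begin
  (φ *φ φ ^φ m) *φ (φ̄ *φ φ̄ ^φ m)  ≡⟨ *φ.interchange φ (φ ^φ m) φ̄ (φ̄ ^φ m) ⟩
  (φ *φ φ̄) *φ (φ ^φ m *φ φ̄ ^φ m)  ≡⟨ cong₂ _*φ_ φ*φ̄≡-1 (φ^m*φ̄^m≡sgn m) ⟩
  -φ 1φ *φ sgn m                  ≡⟨ -1*x≡-x (sgn m) ⟩
  -φ sgn m                        ≡⟨ sgn-suc m ⟨
  sgn (suc m)                     ∎
  where
  open ≡-Reasoning
  -1*x≡-x : ∀ x → -φ 1φ *φ x ≡ -φ x
  -1*x≡-x x = solve (x ∷ []) Qφ-ring

eigenvalue : ℕ → ℕ → Qφ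
eigenvalue d j = φ ^φ (d ∸ j) *φ φ̄ ^φ j

-- As φ φ̄ = −1, the eigenvalue is ± a pure power of φ (if j ≤ d − j) or of φ̄ (if d − j ≤ j).
eigenvalue-φ-form : ∀ d j r → d ≡ j + (j + r) → eigenvalue d j ≡ sgn j *φ φ ^φ r
eigenvalue-φ-form d j r refl = begin
  φ ^φ (j + (j + r) ∸ j) *φ φ̄ ^φ j  ≡⟨ cong (λ t → φ ^φ t *φ φ̄ ^φ j) (ℕ.m+n∸m≡n j (j + r)) ⟩
  φ ^φ (j + r) *φ φ̄ ^φ j            ≡⟨ cong (_*φ φ̄ ^φ j) (^φ-homo-* φ j r) ⟩
  (φ ^φ j *φ φ ^φ r) *φ φ̄ ^φ j      ≡⟨ *φ.xy∙z≈xz∙y (φ ^φ j) (φ ^φ r) (φ̄ ^φ j) ⟩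
  (φ ^φ j *φ φ̄ ^φ j) *φ φ ^φ r      ≡⟨ cong (_*φ φ ^φ r) (φ^m*φ̄^m≡sgn j) ⟩
  sgn j *φ φ ^φ r                   ∎
  where open ≡-Reasoning

eigenvalue-φ̄-form : ∀ d j p r → j ≡ p + r → d ≡ j + p → eigenvalue d j ≡ sgn p *φ φ̄ ^φ r
eigenvalue-φ̄-form d j p r refl refl = begin
  φ ^φ (j + p ∸ j) *φ φ̄ ^φ j        ≡⟨ cong (λ t → φ ^φ t *φ φ̄ ^φ j) (ℕ.m+n∸m≡n j p) ⟩
  φ ^φ p *φ φ̄ ^φ (p + r)            ≡⟨ cong (φ ^φ p *φ_) (^φ-homo-* φ̄ p r) ⟩
  φ ^φ p *φ (φ̄ ^φ p *φ φ̄ ^φ r)      ≡⟨ *φ-assoc (φ ^φ p) (φ̄ ^φ p) (φ̄ ^φ r) ⟨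
  (φ ^φ p *φ φ̄ ^φ p) *φ φ̄ ^φ r      ≡⟨ cong (_*φ φ̄ ^φ r) (φ^m*φ̄^m≡sgn p) ⟩
  sgn p *φ φ̄ ^φ r                   ∎
  where open ≡-Reasoning

φ-branch : ∀ d j s r → sgn s ≡ sgn j → d ≡ j + (j + r) → sgn s *φ φ ^φ r ≡ eigenvalue d j
φ-branch d j s r s≈j d≡ = trans (cong (_*φ φ ^φ r) s≈j) (sym (eigenvalue-φ-form d j r d≡))

φ̄-branch : ∀ d j p s r → sgn s ≡ sgn p → j ≡ p + r → d ≡ j + p → sgn s *φ φ̄ ^φ r ≡ eigenvalue d j
φ̄-branch d j p s r s≈p j≡ d≡ = trans (cong (_*φ φ̄ ^φ r) s≈p) (sym (eigenvalue-φ̄-form d j p r j≡ d≡))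

<⇒≡+suc : ∀ {m n} → m < n → Σ ℕ λ a → n ≡ m + suc a
<⇒≡+suc {m} m<n with ℕ.m≤n⇒∃[o]m+o≡n m<n
... | a , refl = a , sym (ℕ.+-suc m a)

≤⇒≡+ : ∀ {m n} → m ≤ n → Σ ℕ λ a → n ≡ m + a
≤⇒≡+ m≤n with ℕ.m≤n⇒∃[o]m+o≡n m≤n
... | a , refl = a , refl

even-below : ∀ d k j → suc d ≡ k + k → j < k →
  sgn (k + (k ∸ j)) *φ φ ^φ (2 ℕ.* (k ∸ j) ∸ 1) ≡ eigenvalue d j
even-below d k j 1+d≡k+k j<k with <⇒≡+suc j<k
... | a , refl rewrite ℕ.m+n∸m≡n j (suc a) =
  φ-branch d j (j + suc a + suc a) (2 ℕ.* suc a ∸ 1) (trans (cong sgn (ℕ.+-assoc j (suc a) (suc a))) (sgn-+-double j (suc a)))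
           (ℕ.suc-injective (trans 1+d≡k+k (arith j a)))
  where
  arith : ∀ j a → (j + suc a) + (j + suc a) ≡ suc (j + (j + (a + suc (a + 0))))
  arith = solve-∀

odd-below : ∀ d k j → suc d ≡ suc (k + k) → j < k →
  sgn (k + (k ∸ j)) *φ φ ^φ (2 ℕ.* (k ∸ j)) ≡ eigenvalue d j
odd-below d k j 1+d≡1+k+k j<k with <⇒≡+suc j<k
... | a , refl rewrite ℕ.m+n∸m≡n j (suc a) =
  φ-branch d j (j + suc a + suc a) (2 ℕ.* suc a) (trans (cong sgn (ℕ.+-assoc j (suc a) (suc a))) (sgn-+-double j (suc a)))
           (trans (ℕ.suc-injective 1+d≡1+k+k) (arith j a))
  where
  arith : ∀ j a → (j + suc a) + (j + suc a) ≡ j + (j + (suc a + (suc a + 0)))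
  arith = solve-∀

odd-middle : ∀ d k → suc d ≡ suc (k + k) → sgn k ≡ eigenvalue d k
odd-middle d k 1+d≡1+k+k = sym (begin
  φ ^φ (d ∸ k) *φ φ̄ ^φ k  ≡⟨ cong (λ t → φ ^φ (t ∸ k) *φ φ̄ ^φ k) (ℕ.suc-injective 1+d≡1+k+k) ⟩
  φ ^φ (k + k ∸ k) *φ φ̄ ^φ k  ≡⟨ cong (λ t → φ ^φ t *φ φ̄ ^φ k) (ℕ.m+n∸m≡n k k) ⟩
  φ ^φ k *φ φ̄ ^φ k          ≡⟨ φ^m*φ̄^m≡sgn k ⟩
  sgn k                     ∎)
  where open ≡-Reasoning

even-above : ∀ d k j → suc d ≡ k + k → k ≤ j → j < suc d →
  sgn (k + (suc j ∸ k)) *φ φ̄ ^φ (2 ℕ.* (suc j ∸ k) ∸ 1) ≡ eigenvalue d j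
even-above d k j 1+d≡k+k k≤j j<1+d with ≤⇒≡+ k≤j
... | e , refl with <⇒≡+suc (ℕ.+-cancelˡ-< k e k (subst (k + e <_) 1+d≡k+k j<1+d))
...   | p , refl rewrite sym (ℕ.+-suc (e + suc p) e) | ℕ.m+n∸m≡n (e + suc p) (suc e) =
  φ̄-branch d (e + suc p + e) p (e + suc p + suc e) (2 ℕ.* suc e ∸ 1) (trans (cong sgn (sign e p)) (sgn-+-double p (suc e)))
           (j≡ e p)
           (ℕ.suc-injective (trans 1+d≡k+k (d≡ e p)))
  where
  sign : ∀ e p → (e + suc p) + suc e ≡ p + (suc e + suc e)
  sign = solve-∀
  j≡ : ∀ e p → (e + suc p) + e ≡ p + (e + suc (e + 0))
  j≡ = solve-∀
  d≡ : ∀ e p → (e + suc p) + (e + suc p) ≡ suc ((e + suc p) + e + p)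
  d≡ = solve-∀

odd-above : ∀ d k j → suc d ≡ suc (k + k) → k < j → j < suc d →
  sgn (k + (j ∸ k)) *φ φ̄ ^φ (2 ℕ.* (j ∸ k)) ≡ eigenvalue d j
odd-above d k j 1+d≡1+k+k k<j j<1+d with <⇒≡+suc k<j
... | e , refl with ≤⇒≡+ (ℕ.+-cancelˡ-≤ k (suc e) k (subst (k + suc e ≤_) (ℕ.suc-injective 1+d≡1+k+k) (ℕ.s≤s⁻¹ j<1+d)))
...   | p , refl rewrite ℕ.m+n∸m≡n (suc e + p) (suc e) =
  φ̄-branch d (suc e + p + suc e) p (suc e + p + suc e) (2 ℕ.* suc e) (trans (cong sgn (sign e p)) (sgn-+-double p (suc e)))
           (j≡ e p)
           (trans (ℕ.suc-injective 1+d≡1+k+k) (d≡ e p))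
  where
  sign : ∀ e p → (suc e + p) + suc e ≡ p + (suc e + suc e)
  sign = solve-∀
  j≡ : ∀ e p → (suc e + p) + suc e ≡ p + (suc e + (suc e + 0))
  j≡ = solve-∀
  d≡ : ∀ e p → (suc e + p) + (suc e + p) ≡ (suc e + p) + suc e + p
  d≡ = solve-∀

data Parity (n : ℕ) : Bool → Set where
  even : n ≡ ⌊ n /2⌋ + ⌊ n /2⌋       → Parity n true
  odd  : n ≡ suc (⌊ n /2⌋ + ⌊ n /2⌋) → Parity n false

parity : ∀ n → Parity n (n % 2 ≡ᵇ 0)
parity zero          = even refl
parity (suc zero)    = odd refl
parity (suc (suc n)) with n % 2 ≡ᵇ 0 | parity n
... | true  | even n≡k+k   = even (trans (cong (2 +_) n≡k+k) (sym (ℕ.+-suc (suc ⌊ n /2⌋) ⌊ n /2⌋)))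
... | false | odd  n≡1+k+k = odd (trans (cong (2 +_) n≡1+k+k) (cong suc (sym (ℕ.+-suc (suc ⌊ n /2⌋) ⌊ n /2⌋))))

eig≡eigenvalue : ∀ d (j : Fin (suc d)) → eig (suc d) j ≡ eigenvalue d (toℕ j)
eig≡eigenvalue d j
  with suc d % 2 ≡ᵇ 0 | parity (suc d) | toℕ j <ᵇ ⌊ suc d /2⌋ | ℕ.<ᵇ-reflects-< (toℕ j) ⌊ suc d /2⌋
... | true  | even n≡k+k   | true  | ofʸ j<k = even-below d _ (toℕ j) n≡k+k j<k
... | true  | even n≡k+k   | false | ofⁿ j≮k = even-above d _ (toℕ j) n≡k+k (ℕ.≮⇒≥ j≮k) (Fin.toℕ<n j)
... | false | odd  n≡1+k+k | true  | ofʸ j<k = odd-below d _ (toℕ j) n≡1+k+k j<k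
... | false | odd  n≡1+k+k | false | ofⁿ j≮k
  with toℕ j ≡ᵇ ⌊ suc d /2⌋ | proof (toℕ j ℕ.≟ ⌊ suc d /2⌋)
...   | true  | ofʸ j≡k  = trans (odd-middle d ⌊ suc d /2⌋ n≡1+k+k) (cong (eigenvalue d) (sym j≡k))
...   | false | ofⁿ j≢k  = odd-above d _ (toℕ j) n≡1+k+k (ℕ.≤∧≢⇒< (ℕ.≮⇒≥ j≮k) (j≢k ∘ sym)) (Fin.toℕ<n j)

-- The interpolation points F(k) / F(k+1)

fib-ratio : ℕ → Qφ
fib-ratio k = ι (fib k) *φ proj₁ (ι-invertible (fib (suc k)) (fib-suc≢0 k))

fib-ratio-*-fib : ∀ k → fib-ratio k *φ ι (fib (suc k)) ≡ ι (fib k)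
fib-ratio-*-fib k = begin
  (ι (fib k) *φ s) *φ ι (fib (suc k))  ≡⟨ *φ-assoc (ι (fib k)) s (ι (fib (suc k))) ⟩
  ι (fib k) *φ (s *φ ι (fib (suc k)))  ≡⟨ cong (ι (fib k) *φ_) (proj₂ (ι-invertible (fib (suc k)) (fib-suc≢0 k))) ⟩
  ι (fib k) *φ 1φ                      ≡⟨ *φ-identityʳ (ι (fib k)) ⟩
  ι (fib k)                            ∎
  where
  open ≡-Reasoning
  s = proj₁ (ι-invertible (fib (suc k)) (fib-suc≢0 k))

fib-ratio-injective : ∀ {i k} → i < k → fib-ratio k ≢ fib-ratio i
fib-ratio-injective {i} {k} i<k eq = fib-cross≢ i<k (ι-injective (begin
  ι (fib k ℕ.* fib (suc i))                          ≡⟨ ι-homo-* (fib k) (fib (suc i)) ⟩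
  ι (fib k) *φ Bᵢ                                    ≡⟨ cong (_*φ Bᵢ) (fib-ratio-*-fib k) ⟨
  (fib-ratio k *φ Bₖ) *φ Bᵢ                          ≡⟨ cong (λ t → (t *φ Bₖ) *φ Bᵢ) eq ⟩
  (fib-ratio i *φ Bₖ) *φ Bᵢ                          ≡⟨ *φ.xy∙z≈xz∙y (fib-ratio i) Bₖ Bᵢ ⟩
  (fib-ratio i *φ Bᵢ) *φ Bₖ                          ≡⟨ cong (_*φ Bₖ) (fib-ratio-*-fib i) ⟩
  ι (fib i) *φ Bₖ                                    ≡⟨ ι-homo-* (fib i) (fib (suc k)) ⟨
  ι (fib i ℕ.* fib (suc k))                          ∎))
  where
  open ≡-Reasoning
  Bᵢ = ι (fib (suc i))
  Bₖ = ι (fib (suc k))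

-- Each ratio lies in the rational subfield, where nonzero elements are invertible.
fib-ratio-distinct : Distinct fib-ratio
fib-ratio-distinct {i} {k} i<k =
  subst (LeftInvertible 1φ _*φ_) (sym ratios) (ℚ-embed-invertible (qₖ ℚ.- qᵢ) (fib-ratio-injective i<k ∘ from-zero))
  where
  q : ℕ → ℚ
  q m = Qφ.re (ι (fib m)) ℚ.* Qφ.re (proj₁ (ι-invertible (fib (suc m)) (fib-suc≢0 m)))
  qᵢ = q i
  qₖ = q k
  real : ∀ m → fib-ratio m ≡ ℚ-embed (q m)
  real m = ℚ-embed-homo-* (Qφ.re (ι (fib m))) (Qφ.re (proj₁ (ι-invertible (fib (suc m)) (fib-suc≢0 m))))
  ratios : fib-ratio k −φ fib-ratio i ≡ ℚ-embed (qₖ ℚ.- qᵢ)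
  ratios = cong₂ _−φ_ (real k) (real i)
  from-zero : qₖ ℚ.- qᵢ ≡ 0ℚ → fib-ratio k ≡ fib-ratio i
  from-zero e = x−y≡0⇒x≡y (fib-ratio k) (fib-ratio i) (trans ratios (cong ℚ-embed e))

-- Binomial forms

bernstein : ∀ d → ℕ → ℕ → Fin (suc d) → ℕ
bernstein d a b j = (d C toℕ j) ℕ.* a ℕ.^ toℕ j ℕ.* b ℕ.^ (d ∸ toℕ j)

binomialForm : ∀ d → ℕ → ℕ → (Fin (suc d) → Qφ) → Qφ
binomialForm d a b v = Σφ (suc d) (λ j → ι (bernstein d a b j) *φ v j)

binomialForm-cong : ∀ d a b {v w : Fin (suc d) → Qφ} → (∀ j → v j ≡ w j) → binomialForm d a b v ≡ binomialForm d a b w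
binomialForm-cong d a b v≗w = Σφ-cong (suc d) (λ j → cong (ι (bernstein d a b j) *φ_) (v≗w j))

binomialForm-*ʳ : ∀ d a b (v : Fin (suc d) → Qφ) c → binomialForm d a b (λ j → v j *φ c) ≡ binomialForm d a b v *φ c
binomialForm-*ʳ d a b v c =
  trans (Σφ-cong (suc d) (λ j → sym (*φ-assoc (ι (bernstein d a b j)) (v j) c)))
        (sym (*φ-distribʳ-Σφ (suc d) c (λ j → ι (bernstein d a b j) *φ v j)))

binomialForm-− : ∀ d a b (v w : Fin (suc d) → Qφ) →
                 binomialForm d a b (λ j → v j −φ w j) ≡ binomialForm d a b v −φ binomialForm d a b w
binomialForm-− d a b v w =
  trans (Σφ-cong (suc d) (λ j → distrib (ι (bernstein d a b j)) (v j) (w j)))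
        (Σφ-distrib-− (suc d) (λ j → ι (bernstein d a b j) *φ v j) (λ j → ι (bernstein d a b j) *φ w j))
  where
  distrib : ∀ x y z → x *φ (y −φ z) ≡ x *φ y −φ x *φ z
  distrib x y z = solve (x ∷ y ∷ z ∷ []) Qφ-ring

-- At the point (1 : 0) only the top coefficient survives (ℕ's 0 ^ 0 = 1).
binomialForm-1-0 : ∀ d v → binomialForm d 1 0 v ≡ v (fromℕ d)
binomialForm-1-0 d v = begin
  binomialForm d 1 0 v                          ≡⟨ Σφ-select (suc d) (λ j → ι (bernstein d 1 0 j) *φ v j) (fromℕ d) off ⟩
  ι (bernstein d 1 0 (fromℕ d)) *φ v (fromℕ d)  ≡⟨ cong (λ t → ι t *φ v (fromℕ d)) (top (toℕ (fromℕ d)) (Fin.toℕ-fromℕ d)) ⟩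
  1φ *φ v (fromℕ d)                             ≡⟨ *φ-identityˡ (v (fromℕ d)) ⟩
  v (fromℕ d)                                   ∎
  where
  open ≡-Reasoning
  top : ∀ j → j ≡ d → (d C j) ℕ.* 1 ℕ.^ j ℕ.* 0 ℕ.^ (d ∸ j) ≡ 1
  top j refl rewrite nCn≡1 j | ℕ.^-zeroˡ j | ℕ.n∸n≡0 j = refl
  0^[d∸l]≡0 : ∀ d l → l < d → 0 ℕ.^ (d ∸ l) ≡ 0
  0^[d∸l]≡0 (suc d) zero    _         = refl
  0^[d∸l]≡0 (suc d) (suc l) (s≤s l<d) = 0^[d∸l]≡0 d l l<d
  off : ∀ l → l ≢ fromℕ d → ι (bernstein d 1 0 l) *φ v l ≡ 0φ
  off l l≢d = trans (cong (λ t → ι t *φ v l)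
                          (trans (cong ((d C toℕ l) ℕ.* 1 ℕ.^ toℕ l ℕ.*_) (0^[d∸l]≡0 d (toℕ l) l<d))
                                 (ℕ.*-zeroʳ ((d C toℕ l) ℕ.* 1 ℕ.^ toℕ l))))
                    (*φ-zeroˡ (v l))
    where
    l<d : toℕ l < d
    l<d = ℕ.≤∧≢⇒< (Fin.toℕ≤pred[n] l) (λ e → l≢d (Fin.toℕ-injective (trans e (sym (Fin.toℕ-fromℕ d)))))

binomialForm-dehomogenise : ∀ d a b x (v : Fin (suc d) → Qφ) → x *φ ι b ≡ ι a →
  binomialForm d a b v ≡ ι b ^φ d *φ eval (λ j → ι (d C toℕ j) *φ v j) x
binomialForm-dehomogenise d a b x v x*b≡a = sym (begin
  ι b ^φ d *φ eval w x                                 ≡⟨ cong (ι b ^φ d *φ_) (eval-Σφ w x) ⟩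
  ι b ^φ d *φ Σφ (suc d) (λ j → w j *φ x ^φ toℕ j)    ≡⟨ *φ-distribˡ-Σφ (suc d) (ι b ^φ d) (λ j → w j *φ x ^φ toℕ j) ⟩
  Σφ (suc d) (λ j → ι b ^φ d *φ (w j *φ x ^φ toℕ j))  ≡⟨ Σφ-cong (suc d) term ⟩
  binomialForm d a b v                                 ∎)
  where
  open ≡-Reasoning
  w : Fin (suc d) → Qφ
  w j = ι (d C toℕ j) *φ v j
  regroup : ∀ p q c u y → (p *φ q) *φ ((c *φ u) *φ y) ≡ (c *φ (y *φ q) *φ p) *φ u
  regroup p q c u y = solve (p ∷ q ∷ c ∷ u ∷ y ∷ []) Qφ-ring
  term : ∀ j → ι b ^φ d *φ (w j *φ x ^φ toℕ j) ≡ ι (bernstein d a b j) *φ v j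
  term j = begin
    ι b ^φ d *φ (w j *φ x ^φ m)                          ≡⟨ cong (λ t → ι b ^φ t *φ (w j *φ x ^φ m)) (ℕ.m∸n+n≡m (Fin.toℕ≤pred[n] j)) ⟨
    ι b ^φ (d ∸ m ℕ.+ m) *φ (w j *φ x ^φ m)              ≡⟨ cong (_*φ (w j *φ x ^φ m)) (^φ-homo-* (ι b) (d ∸ m) m) ⟩
    (ι b ^φ (d ∸ m) *φ ι b ^φ m) *φ (w j *φ x ^φ m)      ≡⟨ regroup (ι b ^φ (d ∸ m)) (ι b ^φ m) c (v j) (x ^φ m) ⟩
    (c *φ (x ^φ m *φ ι b ^φ m) *φ ι b ^φ (d ∸ m)) *φ v j ≡⟨ cong (λ t → (c *φ t *φ ι b ^φ (d ∸ m)) *φ v j) x^m*b^m≡a^m ⟩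
    (c *φ ι a ^φ m *φ ι b ^φ (d ∸ m)) *φ v j             ≡⟨ cong (_*φ v j) ι-bernstein ⟨
    ι (bernstein d a b j) *φ v j                         ∎
    where
    m = toℕ j
    c = ι (d C m)
    x^m*b^m≡a^m : x ^φ m *φ ι b ^φ m ≡ ι a ^φ m
    x^m*b^m≡a^m = trans (sym (^φ-distrib-* x (ι b) m)) (cong (_^φ m) x*b≡a)
    ι-bernstein : ι (bernstein d a b j) ≡ c *φ ι a ^φ m *φ ι b ^φ (d ∸ m)
    ι-bernstein = begin
      ι ((d C m) ℕ.* a ℕ.^ m ℕ.* b ℕ.^ (d ∸ m))      ≡⟨ ι-homo-* ((d C m) ℕ.* a ℕ.^ m) (b ℕ.^ (d ∸ m)) ⟩
      ι ((d C m) ℕ.* a ℕ.^ m) *φ ι (b ℕ.^ (d ∸ m))    ≡⟨ cong₂ _*φ_ (ι-homo-* (d C m) (a ℕ.^ m)) (ι-homo-^ b (d ∸ m)) ⟩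
      c *φ ι (a ℕ.^ m) *φ ι b ^φ (d ∸ m)              ≡⟨ cong (λ t → c *φ t *φ ι b ^φ (d ∸ m)) (ι-homo-^ a m) ⟩
      c *φ ι a ^φ m *φ ι b ^φ (d ∸ m)                 ∎

ι-ΣN : ∀ n (g : ℕ → ℕ) → ι (ΣN n g) ≡ Σφ n (λ l → ι (g (toℕ l)))
ι-ΣN zero    g = refl
ι-ΣN (suc n) g = trans (ι-homo-+ (g 0) (ΣN n (g ∘ suc))) (cong (ι (g 0) +φ_) (ι-ΣN n (g ∘ suc)))

binomialForm-shift : ∀ d a b (v : Fin (suc d) → Qφ) →
  binomialForm d a b (λ l → Σφ (suc d) (λ m → ι ((d ∸ toℕ l) C toℕ m) *φ v m)) ≡ binomialForm d b (a ℕ.+ b) v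
binomialForm-shift d a b v = begin
  Σφ n (λ l → X l *φ Σφ n (λ m → S l m *φ v m))    ≡⟨ Σφ-cong n (λ l → *φ-distribˡ-Σφ n (X l) (λ m → S l m *φ v m)) ⟩
  Σφ n (λ l → Σφ n (λ m → X l *φ (S l m *φ v m)))  ≡⟨ Σφ-comm n n (λ l m → X l *φ (S l m *φ v m)) ⟩
  Σφ n (λ m → Σφ n (λ l → X l *φ (S l m *φ v m)))  ≡⟨ Σφ-cong n (λ m → Σφ-cong n (λ l → *φ-assoc (X l) (S l m) (v m))) ⟨
  Σφ n (λ m → Σφ n (λ l → (X l *φ S l m) *φ v m))  ≡⟨ Σφ-cong n (λ m → *φ-distribʳ-Σφ n (v m) (λ l → X l *φ S l m)) ⟨
  Σφ n (λ m → Σφ n (λ l → X l *φ S l m) *φ v m)    ≡⟨ Σφ-cong n (λ m → cong (_*φ v m) (column m)) ⟩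
  binomialForm d b (a ℕ.+ b) v                     ∎
  where
  open ≡-Reasoning
  n = suc d
  X : Fin n → Qφ
  X l = ι (bernstein d a b l)
  S : Fin n → Fin n → Qφ
  S l m = ι ((d ∸ toℕ l) C toℕ m)
  column : ∀ m → Σφ n (λ l → X l *φ S l m) ≡ ι (bernstein d b (a ℕ.+ b) m)
  column m = begin
    Σφ n (λ l → X l *φ S l m)                           ≡⟨ Σφ-cong n (λ l → ι-homo-* (bernstein d a b l) ((d ∸ toℕ l) C toℕ m)) ⟨
    Σφ n (λ l → ι (bernstein d a b l ℕ.* ((d ∸ toℕ l) C toℕ m)))
                                                        ≡⟨ ι-ΣN n (λ l → (d C l) ℕ.* a ℕ.^ l ℕ.* b ℕ.^ (d ∸ l) ℕ.* ((d ∸ l) C toℕ m)) ⟨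
    ι (ΣN n (λ l → (d C l) ℕ.* a ℕ.^ l ℕ.* b ℕ.^ (d ∸ l) ℕ.* ((d ∸ l) C toℕ m)))
                                                        ≡⟨ cong ι (trinomial-sum d (toℕ m) a b (Fin.toℕ≤pred[n] m)) ⟩
    ι (bernstein d b (a ℕ.+ b) m)                       ∎

-- Eigenvector polynomials

eigenpoly : ∀ d → ℕ → Fin (suc d) → Qφ
eigenpoly zero    j       = λ _ → 1φ
eigenpoly (suc d) zero    = withQuotient (eigenpoly d zero) 0φ (-φ φ)
eigenpoly (suc d) (suc j) = withQuotient (eigenpoly d j) 0φ (-φ φ̄)

eigenpoly-monic : ∀ d j → eigenpoly d j (fromℕ d) ≡ 1φ
eigenpoly-monic zero    j       = refl
eigenpoly-monic (suc d) zero    = trans (withQuotient-last d (eigenpoly d zero) 0φ (-φ φ)) (eigenpoly-monic d zero)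
eigenpoly-monic (suc d) (suc j) = trans (withQuotient-last d (eigenpoly d j) 0φ (-φ φ̄)) (eigenpoly-monic d j)

eval-eigenpoly : ∀ d j y → j ≤ d → eval (eigenpoly d j) y ≡ (y +φ φ) ^φ (d ∸ j) *φ (y +φ φ̄) ^φ j
eval-eigenpoly zero    zero    y _ = trans (x+y*0≡x 1φ y) (sym (*φ-identityˡ 1φ))
eval-eigenpoly (suc d) zero    y _ = begin
  eval (eigenpoly (suc d) zero) y                       ≡⟨ eval-withQuotient (eigenpoly d zero) 0φ (-φ φ) y ⟩
  0φ +φ (y +φ φ) *φ eval (eigenpoly d zero) y           ≡⟨ +φ-identityˡ _ ⟩
  (y +φ φ) *φ eval (eigenpoly d zero) y                 ≡⟨ cong ((y +φ φ) *φ_) (eval-eigenpoly d zero y z≤n) ⟩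
  (y +φ φ) *φ ((y +φ φ) ^φ d *φ 1φ)                     ≡⟨ *φ-assoc (y +φ φ) ((y +φ φ) ^φ d) 1φ ⟨
  (y +φ φ) ^φ suc d *φ 1φ                               ∎
  where open ≡-Reasoning
eval-eigenpoly (suc d) (suc j) y (s≤s j≤d) = begin
  eval (eigenpoly (suc d) (suc j)) y                    ≡⟨ eval-withQuotient (eigenpoly d j) 0φ (-φ φ̄) y ⟩
  0φ +φ (y +φ φ̄) *φ eval (eigenpoly d j) y              ≡⟨ +φ-identityˡ _ ⟩
  (y +φ φ̄) *φ eval (eigenpoly d j) y                    ≡⟨ cong ((y +φ φ̄) *φ_) (eval-eigenpoly d j y j≤d) ⟩
  (y +φ φ̄) *φ ((y +φ φ) ^φ (d ∸ j) *φ (y +φ φ̄) ^φ j)    ≡⟨ *φ.x∙yz≈y∙xz (y +φ φ̄) ((y +φ φ) ^φ (d ∸ j)) ((y +φ φ̄) ^φ j) ⟩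
  (y +φ φ) ^φ (d ∸ j) *φ (y +φ φ̄) ^φ suc j              ∎
  where open ≡-Reasoning

^φ-comm : ∀ x m k → (x ^φ m) ^φ k ≡ (x ^φ k) ^φ m
^φ-comm x m k = trans (^φ-assocʳ x m k) (trans (cong (x ^φ_) (ℕ.*-comm m k)) (sym (^φ-assocʳ x k m)))

-- Inverting X and diagonalising R

module _ (d : ℕ) where

  private
    n = suc d

  -- Row i of Xm (suc d) for every i : ℕ, so that (Xm (suc d) · A) i j is Xrow (toℕ i) (λ l → A l j) by definition.
  Xrow : ℕ → (Fin (suc d) → Qφ) → Qφ
  Xrow i = binomialForm d (Fm1 i) (fib i)

  weighted : (Fin (suc d) → Qφ) → Fin (suc d) → Qφ
  weighted v j = ι (d C toℕ j) *φ v j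

  binomial-invertible : (j : Fin (suc d)) → LeftInvertible 1φ _*φ_ (ι (d C toℕ j))
  binomial-invertible j = ι-invertible (d C toℕ j) (k≤n⇒nCk≢0 d (toℕ j) (Fin.toℕ≤pred[n] j))

  unweighted : (Fin (suc d) → Qφ) → Fin (suc d) → Qφ
  unweighted u j = proj₁ (binomial-invertible j) *φ u j

  weighted-unweighted : ∀ u j → weighted (unweighted u) j ≡ u j
  weighted-unweighted u j = begin
    ι (d C toℕ j) *φ (c⁻¹ *φ u j)  ≡⟨ *φ-assoc (ι (d C toℕ j)) c⁻¹ (u j) ⟨
    (ι (d C toℕ j) *φ c⁻¹) *φ u j  ≡⟨ cong (_*φ u j) (trans (*φ-comm (ι (d C toℕ j)) c⁻¹) (proj₂ (binomial-invertible j))) ⟩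
    1φ *φ u j                      ≡⟨ *φ-identityˡ (u j) ⟩
    u j                            ∎
    where
    open ≡-Reasoning
    c⁻¹ = proj₁ (binomial-invertible j)

  unweighted-top : ∀ u → unweighted u (fromℕ d) ≡ u (fromℕ d)
  unweighted-top u = begin
    c⁻¹ *φ u (fromℕ d)                       ≡⟨ cong (c⁻¹ *φ_) (*φ-identityˡ (u (fromℕ d))) ⟨
    c⁻¹ *φ (1φ *φ u (fromℕ d))               ≡⟨ cong (λ t → c⁻¹ *φ (ι t *φ u (fromℕ d))) (trans (cong (d C_) (Fin.toℕ-fromℕ d)) (nCn≡1 d)) ⟨
    c⁻¹ *φ (ι (d C toℕ (fromℕ d)) *φ u (fromℕ d))  ≡⟨ *φ-assoc c⁻¹ (ι (d C toℕ (fromℕ d))) (u (fromℕ d)) ⟨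
    (c⁻¹ *φ ι (d C toℕ (fromℕ d))) *φ u (fromℕ d)  ≡⟨ cong (_*φ u (fromℕ d)) (proj₂ (binomial-invertible (fromℕ d))) ⟩
    1φ *φ u (fromℕ d)                        ≡⟨ *φ-identityˡ (u (fromℕ d)) ⟩
    u (fromℕ d)                              ∎
    where
    open ≡-Reasoning
    c⁻¹ : Qφ
    c⁻¹ = proj₁ (binomial-invertible (fromℕ d))

  Xrow-zero : ∀ v → Xrow 0 v ≡ v (fromℕ d)
  Xrow-zero = binomialForm-1-0 d

  Xrow-suc : ∀ k v → Xrow (suc k) v ≡ ι (fib (suc k)) ^φ d *φ eval (weighted v) (fib-ratio k)
  Xrow-suc k v = binomialForm-dehomogenise d (fib k) (fib (suc k)) (fib-ratio k) v (fib-ratio-*-fib k)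

  fib-power-invertible : ∀ k → LeftInvertible 1φ _*φ_ (ι (fib (suc k)) ^φ d)
  fib-power-invertible k = ^φ-invertible (ι-invertible (fib (suc k)) (fib-suc≢0 k)) d

  X-kernel : ∀ v → (∀ i → i ≤ d → Xrow i v ≡ 0φ) → ∀ j → v j ≡ 0φ
  X-kernel v Xv≡0 j = invertible-cancelˡ (binomial-invertible j) (v j) (weighted-zero j)
    where
    top-zero : weighted v (fromℕ d) ≡ 0φ
    top-zero = trans (cong (ι (d C toℕ (fromℕ d)) *φ_) (trans (sym (Xrow-zero v)) (Xv≡0 0 z≤n)))
                     (*φ-zeroʳ (ι (d C toℕ (fromℕ d))))
    roots : ∀ k → k < d → eval (weighted v) (fib-ratio k) ≡ 0φ
    roots k k<d = invertible-cancelˡ (fib-power-invertible k) (eval (weighted v) (fib-ratio k))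
                                     (trans (sym (Xrow-suc k v)) (Xv≡0 (suc k) k<d))
    weighted-zero : ∀ j → weighted v j ≡ 0φ
    weighted-zero = lowDegree-roots⇒zero d fib-ratio fib-ratio-distinct (weighted v) top-zero roots

  X-solve : (z : ℕ → Qφ) → Σ (Fin (suc d) → Qφ) λ v → ∀ i → i ≤ d → Xrow i v ≡ z i
  X-solve z = unweighted u , solves
    where
    scaled : ℕ → Qφ
    scaled k = proj₁ (fib-power-invertible k) *φ z (suc k)
    u-spec : Σ (Fin (suc d) → Qφ) λ u → u (fromℕ d) ≡ z 0 × (∀ k → k < d → eval u (fib-ratio k) ≡ scaled k)
    u-spec = interpolant d fib-ratio fib-ratio-distinct (z 0) scaled
    u : Fin (suc d) → Qφ
    u = proj₁ u-spec
    solves : ∀ i → i ≤ d → Xrow i (unweighted u) ≡ z i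
    solves zero    _   = trans (Xrow-zero (unweighted u)) (trans (unweighted-top u) (proj₁ (proj₂ u-spec)))
    solves (suc k) k<d = begin
      Xrow (suc k) (unweighted u)                   ≡⟨ Xrow-suc k (unweighted u) ⟩
      B *φ eval (weighted (unweighted u)) (fib-ratio k) ≡⟨ cong (B *φ_) (eval-cong (fib-ratio k) (weighted-unweighted u)) ⟩
      B *φ eval u (fib-ratio k)                     ≡⟨ cong (B *φ_) (proj₂ (proj₂ u-spec) k k<d) ⟩
      B *φ (B⁻¹ *φ z (suc k))                       ≡⟨ *φ-assoc B B⁻¹ (z (suc k)) ⟨
      (B *φ B⁻¹) *φ z (suc k)                       ≡⟨ cong (_*φ z (suc k)) (trans (*φ-comm B B⁻¹) (proj₂ (fib-power-invertible k))) ⟩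
      1φ *φ z (suc k)                               ≡⟨ *φ-identityˡ (z (suc k)) ⟩
      z (suc k)                                     ∎
      where
      open ≡-Reasoning
      B B⁻¹ : Qφ
      B = ι (fib (suc k)) ^φ d
      B⁻¹ = proj₁ (fib-power-invertible k)

  X-cancelˡ : {A B : Mat n} → Xm n · A ≈M Xm n · B → A ≈M B
  X-cancelˡ {A} {B} XA≈XB i j = x−y≡0⇒x≡y (A i j) (B i j) (X-kernel (λ l → A l j −φ B l j) Xdiff≡0 i)
    where
    open ≡-Reasoning
    Xdiff≡0 : ∀ r → r ≤ d → Xrow r (λ l → A l j −φ B l j) ≡ 0φ
    Xdiff≡0 r r≤d = begin
      Xrow r (λ l → A l j −φ B l j)                        ≡⟨ binomialForm-− d (Fm1 r) (fib r) (λ l → A l j) (λ l → B l j) ⟩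
      Xrow r (λ l → A l j) −φ Xrow r (λ l → B l j)       ≡⟨ cong (_−φ Xrow r (λ l → B l j)) XA≈XB-at-r ⟩
      Xrow r (λ l → B l j) −φ Xrow r (λ l → B l j)       ≡⟨ -φ-inverseʳ (Xrow r (λ l → B l j)) ⟩
      0φ                                                     ∎
      where
      XA≈XB-at-r : Xrow r (λ l → A l j) ≡ Xrow r (λ l → B l j)
      XA≈XB-at-r = subst (λ t → Xrow t (λ l → A l j) ≡ Xrow t (λ l → B l j))
                         (Fin.toℕ-fromℕ< (s≤s r≤d)) (XA≈XB (fromℕ< (s≤s r≤d)) j)

  unit : Fin n → ℕ → Qφ
  unit k i = if i ℕ.≡ᵇ toℕ k then 1φ else 0φ

  Y : Mat n
  Y j k = proj₁ (X-solve (unit k)) j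

  X·Y≈I : Xm n · Y ≈M idM
  X·Y≈I i k = proj₂ (X-solve (unit k)) (toℕ i) (Fin.toℕ≤pred[n] i)

  Y·X≈I : Y · Xm n ≈M idM
  Y·X≈I = X-cancelˡ (begin
    Xm n · (Y · Xm n)   ≈⟨ ·-assoc (Xm n) Y (Xm n) ⟨
    (Xm n · Y) · Xm n   ≈⟨ ·-congˡ (Xm n) X·Y≈I ⟩
    idM · Xm n          ≈⟨ idM-· (Xm n) ⟩
    Xm n                ≈⟨ ·-idM (Xm n) ⟨
    Xm n · idM          ∎)
    where open SetoidReasoning Mat-setoid

  Ev : Mat n
  Ev l j = unweighted (eigenpoly d (toℕ j)) l

  Xrow-Ev : ∀ i j → Xrow i (λ l → Ev l j) ≡ eigenvalue d (toℕ j) ^φ i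
  Xrow-Ev zero    j = trans (Xrow-zero (λ l → Ev l j))
                            (trans (unweighted-top (eigenpoly d (toℕ j))) (eigenpoly-monic d (toℕ j)))
  Xrow-Ev (suc k) j = begin
    Xrow (suc k) (λ l → Ev l j)                          ≡⟨ Xrow-suc k (λ l → Ev l j) ⟩
    B ^φ d *φ eval (weighted (λ l → Ev l j)) x           ≡⟨ cong (B ^φ d *φ_) (eval-cong x (weighted-unweighted (eigenpoly d m))) ⟩
    B ^φ d *φ eval (eigenpoly d m) x                       ≡⟨ cong (B ^φ d *φ_) (eval-eigenpoly d m x m≤d) ⟩
    B ^φ d *φ ((x +φ φ) ^φ p *φ (x +φ φ̄) ^φ m)             ≡⟨ cong (λ t → B ^φ t *φ ((x +φ φ) ^φ p *φ (x +φ φ̄) ^φ m)) (ℕ.m∸n+n≡m m≤d) ⟨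
    B ^φ (p ℕ.+ m) *φ ((x +φ φ) ^φ p *φ (x +φ φ̄) ^φ m)     ≡⟨ cong (_*φ ((x +φ φ) ^φ p *φ (x +φ φ̄) ^φ m)) (^φ-homo-* B p m) ⟩
    (B ^φ p *φ B ^φ m) *φ ((x +φ φ) ^φ p *φ (x +φ φ̄) ^φ m) ≡⟨ *φ.interchange (B ^φ p) (B ^φ m) ((x +φ φ) ^φ p) ((x +φ φ̄) ^φ m) ⟩
    (B ^φ p *φ (x +φ φ) ^φ p) *φ (B ^φ m *φ (x +φ φ̄) ^φ m) ≡⟨ cong₂ _*φ_ (^φ-distrib-* B (x +φ φ) p) (^φ-distrib-* B (x +φ φ̄) m) ⟨
    (B *φ (x +φ φ)) ^φ p *φ (B *φ (x +φ φ̄)) ^φ m           ≡⟨ cong₂ (λ s t → s ^φ p *φ t ^φ m) (power-of-root φ φ²≡φ+1) (power-of-root φ̄ φ̄²≡φ̄+1) ⟩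
    (φ ^φ suc k) ^φ p *φ (φ̄ ^φ suc k) ^φ m                 ≡⟨ cong₂ _*φ_ (^φ-comm φ (suc k) p) (^φ-comm φ̄ (suc k) m) ⟩
    (φ ^φ p) ^φ suc k *φ (φ̄ ^φ m) ^φ suc k                 ≡⟨ ^φ-distrib-* (φ ^φ p) (φ̄ ^φ m) (suc k) ⟨
    eigenvalue d m ^φ suc k                                ∎
    where
    open ≡-Reasoning
    m = toℕ j
    p = d ∸ m
    m≤d = Fin.toℕ≤pred[n] j
    B = ι (fib (suc k))
    x = fib-ratio k
    power-of-root : ∀ γ → γ *φ γ ≡ γ +φ 1φ → B *φ (x +φ γ) ≡ γ ^φ suc k
    power-of-root γ γ²≡γ+1 = begin
      B *φ (x +φ γ)             ≡⟨ *φ-distribˡ B x γ ⟩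
      B *φ x +φ B *φ γ          ≡⟨ cong (_+φ B *φ γ) (trans (*φ-comm B x) (fib-ratio-*-fib k)) ⟩
      ι (fib k) +φ B *φ γ       ≡⟨ Fm1+fib*γ≡γ^ γ γ²≡γ+1 (suc k) ⟩
      γ ^φ suc k                ∎

  X·Ev≈V : Xm n · Ev ≈M Vm n
  X·Ev≈V i j = trans (Xrow-Ev (toℕ i) j) (cong (_^φ toℕ i) (sym (eig≡eigenvalue d j)))

  Y·V≈Ev : Y · Vm n ≈M Ev
  Y·V≈Ev = X-cancelˡ (begin
    Xm n · (Y · Vm n)   ≈⟨ ·-assoc (Xm n) Y (Vm n) ⟨
    (Xm n · Y) · Vm n   ≈⟨ ·-congˡ (Vm n) X·Y≈I ⟩
    idM · Vm n          ≈⟨ idM-· (Vm n) ⟩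
    Vm n                ≈⟨ X·Ev≈V ⟨
    Xm n · Ev           ∎)
    where open SetoidReasoning Mat-setoid

  Sm : Mat n
  Sm l m = ι ((d ∸ toℕ l) C toℕ m)

  X·Sm·Ev≈X·Ev·Λ : Xm n · (Sm · Ev) ≈M Xm n · (Ev · diag (eig n))
  X·Sm·Ev≈X·Ev·Λ i j = begin
    Xrow (toℕ i) (λ l → (Sm · Ev) l j)                 ≡⟨ binomialForm-shift d (Fm1 (toℕ i)) (fib (toℕ i)) (λ l → Ev l j) ⟩
    binomialForm d (fib (toℕ i)) (Fm1 (toℕ i) ℕ.+ fib (toℕ i)) (λ l → Ev l j)
                                                        ≡⟨ cong (λ t → binomialForm d (fib (toℕ i)) t (λ l → Ev l j)) (fib-suc≡Fm1+fib (toℕ i)) ⟨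
    Xrow (suc (toℕ i)) (λ l → Ev l j)                 ≡⟨ Xrow-Ev (suc (toℕ i)) j ⟩
    λⱼ *φ λⱼ ^φ toℕ i                                    ≡⟨ *φ-comm λⱼ (λⱼ ^φ toℕ i) ⟩
    λⱼ ^φ toℕ i *φ λⱼ                                    ≡⟨ cong₂ _*φ_ (Xrow-Ev (toℕ i) j) (eig≡eigenvalue d j) ⟨
    Xrow (toℕ i) (λ l → Ev l j) *φ eig n j            ≡⟨ binomialForm-*ʳ d (Fm1 (toℕ i)) (fib (toℕ i)) (λ l → Ev l j) (eig n j) ⟨
    Xrow (toℕ i) (λ l → Ev l j *φ eig n j)            ≡⟨ binomialForm-cong d (Fm1 (toℕ i)) (fib (toℕ i)) (λ l → ·-diag Ev (eig n) l j) ⟨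
    Xrow (toℕ i) (λ l → (Ev · diag (eig n)) l j)      ∎
    where
    open ≡-Reasoning
    λⱼ = eigenvalue d (toℕ j)

  Sm·Ev≈Ev·Λ : Sm · Ev ≈M Ev · diag (eig n)
  Sm·Ev≈Ev·Λ = X-cancelˡ X·Sm·Ev≈X·Ev·Λ

  Rm·Km≈Km·Sm : Rm n · Km n ≈M Km n · Sm
  Rm·Km≈Km·Sm i m = begin
    (Rm n · Km n) i m                          ≡⟨ ·-Km (Rm n) i m ⟩
    ι (toℕ i C (d ∸ toℕ (opposite m)))         ≡⟨ cong (λ t → ι (toℕ i C t)) (d∸opposite m) ⟩
    ι (toℕ i C toℕ m)                          ≡⟨ cong (λ t → ι (t C toℕ m)) (d∸opposite i) ⟨
    ι ((d ∸ toℕ (opposite i)) C toℕ m)         ≡⟨ Km-· Sm i m ⟨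
    (Km n · Sm) i m                            ∎
    where
    open ≡-Reasoning
    d∸opposite : ∀ (l : Fin n) → d ∸ toℕ (opposite l) ≡ toℕ l
    d∸opposite l = trans (cong (d ∸_) (Fin.opposite-prop l)) (ℕ.m∸[m∸n]≡n (Fin.toℕ≤pred[n] l))

  W≈Km·Ev : Km n · Y · Vm n ≈M Km n · Ev
  W≈Km·Ev = begin
    Km n · Y · Vm n     ≈⟨ ·-assoc (Km n) Y (Vm n) ⟩
    Km n · (Y · Vm n)   ≈⟨ ·-congʳ (Km n) Y·V≈Ev ⟩
    Km n · Ev           ∎
    where open SetoidReasoning Mat-setoid

  R·W≈W·Λ : Rm n · (Km n · Y · Vm n) ≈M (Km n · Y · Vm n) · diag (eig n)
  R·W≈W·Λ = begin
    Rm n · (Km n · Y · Vm n)       ≈⟨ ·-congʳ (Rm n) W≈Km·Ev ⟩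
    Rm n · (Km n · Ev)             ≈⟨ ·-assoc (Rm n) (Km n) Ev ⟨
    (Rm n · Km n) · Ev             ≈⟨ ·-congˡ Ev Rm·Km≈Km·Sm ⟩
    (Km n · Sm) · Ev               ≈⟨ ·-assoc (Km n) Sm Ev ⟩
    Km n · (Sm · Ev)               ≈⟨ ·-congʳ (Km n) Sm·Ev≈Ev·Λ ⟩
    Km n · (Ev · diag (eig n))     ≈⟨ ·-assoc (Km n) Ev (diag (eig n)) ⟨
    (Km n · Ev) · diag (eig n)     ≈⟨ ·-congˡ (diag (eig n)) W≈Km·Ev ⟨
    (Km n · Y · Vm n) · diag (eig n) ∎
    where open SetoidReasoning Mat-setoid

mainTheorem5 : (n : ℕ) → 1 ≤ n →
    Σ (Mat n) (λ Y →
      (Xm n · Y ≈M idM) × (Y · Xm n ≈M idM) ×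
      (Rm n · (Km n · Y · Vm n) ≈M (Km n · Y · Vm n) · diag (eig n)))
mainTheorem5 (suc d) _ = Y d , X·Y≈I d , Y·X≈I d , R·W≈W·Λ d
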